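{- Let $\Lambda$ be a numerical semigroup with rank $k(\Lambda)$, multiplicity $m=\lambda_1$, $u=\lambda_2-\lambda_1$, $v=\lambda_3-\lambda_2$, and seed bitstream $S=S(\Lambda)$. Let $n_c(\Lambda)$, $n_{gc}(\Lambda)$, $n_{ggc}(\Lambda)$ be the numbers of children, grandchildren and great-grandchildren of $\Lambda$ in the semigroup tree. Then $$n_c(\Lambda)=\begin{cases}1 & k(\Lambda)=0,\\ m & k(\Lambda)=1,\\ m-1 & k(\Lambda)=2,\\ w_0^{m-1}(S) & k(\Lambda)\ge3,\end{cases}\qquad n_{gc}(\Lambda)=\begin{cases}2 & k(\Lambda)=0,\\ \binom m2+3 & k(\Lambda)=1,\\ \binom{n_c(\Lambda)}2+w_0^{u-1}(S\land(S\ll m)) & k(\Lambda)>1,\end{cases}$$ $$n_{ggc}(\Lambda)=\begin{cases}4 & k(\Lambda)=0,\\ \binom m3+3m+1 & k(\Lambda)=1,\ m\in\{2,3\},\\ \binom m3+3m+3 & k(\Lambda)=1,\ m\ge4,\\ \binom{m-1}3+(u-\delta_a)(m-2)+\delta_b+2\delta_c+\delta_d & k(\Lambda)=2,\\ \binom{n_c(\Lambda)}3+w_0^{u-1}(S\land(S\ll m))\,(n_c(\Lambda)-1)+w_0^{v-1}\big(S\land(S\ll u)\land(S\ll(u+m))\big) & k(\Lambda)\ge3,\end{cases}$$ where $\delta_a=1$ if $m<2u$ and $0$ otherwise; $\delta_b=1$ if $u=m$ or $2u\ne m$ and $0$ otherwise; $\delta_c=1$ if $u<m-1$ and $2u+1\ne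 m$ and $0$ otherwise; $\delta_d=1$ if $u=m-1$ and $0$ otherwise.
   Context: A numerical semigroup is a cofinite submonoid of $\mathbb N$, with elements $\lambda_0=0<\lambda_1<\lambda_2<\dots$. The genus $g$ is the number of gaps, the conductor $c$ is the largest gap plus one (the Frobenius number $c-1$ is the largest gap), and the rank is $k=c-g$, so $\lambda_k=c$. A primitive element is a nonzero element of $\Lambda$ that is not a sum of two nonzero elements of $\Lambda$; a right generator is a primitive element larger than the largest gap. The semigroup tree is rooted at $\mathbb N$, and the children of a semigroup $\Lambda$ are the semigroups $\Lambda\setminus\{\mu\}$ for $\mu$ a right generator of $\Lambda$ (the unique child of $\mathbb N$ is $\mathbb N\setminus\{1\}$); grandchildren are children of children and great-grandchildren are children of grandchildren. For $p<k$, an element $\lambda_s\ge c$ of $\Lambda$ is an order-$p$ seed if $\lambda_s+\lambda_p\neq\lambda_i+\lambda_j$ for all $p<i\le j<s$. The seed bitstream is $S(\Lambda)=S_0\dots S_{c-1}$ where, for $0\le i\le c-1$, letting $j$ be the unique index with $\lambda_j\le i<\lambda_{j+1}$, $S_i=1$ if $c+i-\lambda_j$ is an order-$j$ seed and $S_i=0$ otherwise; bitstreams are extended by zeros to the right as needed. For a bitstream $a$: $a\ll t$ is the bitstream whose $i$-th entry is $a_{i+t}$; $a\land a'$ is the entrywise AND; $w_i^j(a)$ is the number of indices $\ell$ with $i\le\ell\le j$ and $a_\ell=1$. Binomial coefficients $\binom nr$ with $n<r$ are $0$. -}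

module Defs where

open import Data.Nat using (ℕ; zero; suc; _+_; _*_; _∸_; _≤_; _⊔_; _≤ᵇ_; _<ᵇ_; _≡ᵇ_)
open import Data.Bool using (Bool; true; false; _∧_; not; if_then_else_)
open import Data.List using (List; []; _∷_; length; filterᵇ; upTo; map)
open import Data.List using (foldr)
open import Data.Nat.ListAction using (sum)
open import Relation.Binary.PropositionalEquality using (_≡_)

-- Raw data of a cofinite subset of ℕ: a (Boolean) membership test and a
-- bound beyond which every natural number is a member.

all : {A : Set} → (A → Bool) → List A → Bool
all p = foldr (λ x b → p x ∧ b) true

record Raw : Set where
  constructor mkRaw
  field
    mem   : ℕ → Bool
    bound : ℕ

record NumericalSemigroup : Set where
  field
    raw      : Raw
  open Raw raw
  field
    mem-0        : mem 0 ≡ true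
    mem-+        : ∀ a b → mem a ≡ true → mem b ≡ true → mem (a + b) ≡ true
    mem-cofinite : ∀ n → bound ≤ n → mem n ≡ true

module _ (R : Raw) where
  open Raw R

  -- conductor c = (largest gap) + 1, or 0 if there are no gaps
  -- (scan downwards from the bound for the largest non-member).
  private
    condFrom : ℕ → ℕ
    condFrom zero    = 0
    condFrom (suc n) = if mem n then condFrom n else suc n

  conductor : ℕ
  conductor = condFrom bound

  -- genus: number of gaps (all gaps are below the conductor)
  genus : ℕ
  genus = length (filterᵇ (λ n → not (mem n)) (upTo conductor))

  rank : ℕ
  rank = conductor ∸ genus

  private
    nth : List ℕ → ℕ → ℕ
    nth []       _       = 0
    nth (x ∷ xs) zero    = x
    nth (x ∷ xs) (suc i) = nth xs i

  -- λ i : the i-th element of Λ (λ 0 = 0 < λ 1 < …); it is ≤ c + i.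
  elt : ℕ → ℕ
  elt i = nth (filterᵇ mem (upTo (conductor + suc i))) i

  index : ℕ → ℕ
  index x = length (filterᵇ mem (upTo x))

  isPrimitive : ℕ → Bool
  isPrimitive μ = not (μ ≡ᵇ 0) ∧ mem μ
    ∧ all (λ a → not ((1 ≤ᵇ a) ∧ (1 ≤ᵇ (μ ∸ a)) ∧ mem a ∧ mem (μ ∸ a))) (upTo μ)

  -- right generator: primitive and larger than the largest gap (i.e. ≥ c)
  isRightGen : ℕ → Bool
  isRightGen μ = isPrimitive μ ∧ (conductor ≤ᵇ μ)

  -- all right generators; every primitive element is ≤ c + λ₁, so the
  -- search range [0, c + λ₁] is exhaustive.
  rightGens : List ℕ
  rightGens = filterᵇ isRightGen (upTo (suc (conductor + elt 1)))

  -- Λ ∖ {μ}  (for μ ≥ c, every n ≥ max(bound, μ+1) is still a member)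
  remove : ℕ → Raw
  remove μ = mkRaw (λ n → mem n ∧ not (n ≡ᵇ μ)) (bound ⊔ suc μ)

  children : List Raw
  children = map remove rightGens

  isSeed : ℕ → ℕ → Bool
  isSeed p x = (p <ᵇ rank) ∧ mem x ∧ (conductor ≤ᵇ x)
    ∧ all (λ i → all (λ j → not ((p <ᵇ i) ∧ (i ≤ᵇ j) ∧
                                  ((elt s + elt p) ≡ᵇ (elt i + elt j))))
                     (upTo s))
          (upTo s)
    where s = index x

  -- seed bitstream S(Λ) (extended by zeros beyond c - 1):
  -- for i < c, j is the index of the largest element ≤ i.
  seedStream : ℕ → Bool
  seedStream i = if i <ᵇ conductor
                 then isSeed j (conductor + i ∸ elt j)
                 else false
    where j = length (filterᵇ mem (upTo (suc i))) ∸ 1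

nChildren : Raw → ℕ
nChildren R = length (rightGens R)

nGrandchildren : Raw → ℕ
nGrandchildren R = sum (map nChildren (children R))

nGreatGrandchildren : Raw → ℕ
nGreatGrandchildren R = sum (map nGrandchildren (children R))

Bitstream : Set
Bitstream = ℕ → Bool

_≪_ : Bitstream → ℕ → Bitstream
(a ≪ t) i = a (i + t)

_⋀_ : Bitstream → Bitstream → Bitstream
(a ⋀ b) i = a i ∧ b i

w : ℕ → ℕ → Bitstream → ℕ
w i j a = length (filterᵇ (λ ℓ → (i ≤ᵇ ℓ) ∧ a ℓ) (upTo (suc j)))

δ : Bool → ℕ
δ true  = 1
δ false = 0

{-# OPTIONS --safe #-}
-- Every right generator μ of Λ lies in [c, c + m), and the right generators of the child Λ ∖ {μ}
-- are the right generators of Λ above μ together with μ + m, the latter exactly when μ + m has no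
-- decomposition λᵢ + λⱼ with 1 < i ≤ j, i.e. when μ is an order-1 seed.  Summing over the children
-- gives C(n_c, 2) plus the number of right generators that are order-1 seeds.  One generation
-- further, a right generator y > μ is an order-1 seed of Λ ∖ {μ} iff it is one of Λ or every
-- decomposition of y + m uses μ, and μ + m may itself be one; summing gives C(n_c, 3), the pairs of
-- right generators containing an order-1 seed, and these additional seeds.
-- For rank ≥ 2 the bits S_i and S_{m+i} record whether c + i is a right generator and an order-1
-- seed, and for rank ≥ 3 the bit S_{u+m+i} records whether c + i is an order-2 seed; in ranks 0, 1
-- and 2 all these quantities are computed explicitly.
module Submission where

open import Defs
open import Data.Nat
open import Data.Nat.Properties
open import Data.Nat.Combinatorics using (_C_; nCk+nC[k+1]≡[n+1]C[k+1]; nC1≡n)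
open import Data.Nat.ListAction using (sum)
open import Data.Nat.Tactic.RingSolver
open import Data.Bool using (Bool; true; false; _∧_; _∨_; not; if_then_else_; T)
open import Data.Bool.Properties using (∧-identityʳ; ∧-zeroʳ)
open import Data.List using (List; _∷_; length; filterᵇ; upTo; applyUpTo; map)
import Data.List
open import Data.List.Properties using (map-∘)
open import Data.Product using (Σ; _×_; _,_; proj₁; proj₂)
open import Data.Sum using (_⊎_; inj₁; inj₂)
open import Data.Empty using (⊥; ⊥-elim)
open import Data.Unit using (tt)
open import Function using (_∘_)
open import Relation.Nullary using (¬_; yes; no)
open import Relation.Nullary.Decidable.Core using (T?)
open import Relation.Binary.Definitions using (tri<; tri≈; tri>)
open import Relation.Binary.PropositionalEquality

T∧ : ∀ {a b} → T a → T b → T (a ∧ b)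
T∧ {true} {true} _ _ = tt

T∧₁ : ∀ {a b} → T (a ∧ b) → T a
T∧₁ {true} _ = tt

T∧₂ : ∀ {a b} → T (a ∧ b) → T b
T∧₂ {true} {true} _ = tt

Tnot : ∀ {a} → ¬ T a → T (not a)
Tnot {false} _ = tt
Tnot {true} h = h tt

Tnot⁻ : ∀ {a} → T (not a) → ¬ T a
Tnot⁻ {false} _ ()
Tnot⁻ {true} ()

Tdec : ∀ a → T a ⊎ ¬ T a
Tdec true = inj₁ tt
Tdec false = inj₂ (λ ())

bool-ext : ∀ {a b} → (T a → T b) → (T b → T a) → a ≡ b
bool-ext {true} {true} f g = refl
bool-ext {true} {false} f g = ⊥-elim (f tt)
bool-ext {false} {true} f g = ⊥-elim (g tt)
bool-ext {false} {false} f g = refl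

false≢T : ∀ {a} → T a → a ≡ false → ⊥
false≢T {true} _ ()

≡true : ∀ {a} → T a → a ≡ true
≡true {true} _ = refl

Tfalse : ∀ {a} → ¬ T a → a ≡ false
Tfalse {true} h = ⊥-elim (h tt)
Tfalse {false} _ = refl

δT : ∀ {a} → T a → δ a ≡ 1
δT {true} _ = refl

δF : ∀ {a} → ¬ T a → δ a ≡ 0
δF {true} h = ⊥-elim (h tt)
δF {false} _ = refl

δ-∧-false : ∀ a → δ (a ∧ false) ≡ 0
δ-∧-false a = cong δ (∧-zeroʳ a)

≤ᵇT : ∀ {m n} → m ≤ n → T (m ≤ᵇ n)
≤ᵇT = ≤⇒≤ᵇ
T≤ᵇ : ∀ {m n} → T (m ≤ᵇ n) → m ≤ n
T≤ᵇ {m} {n} = ≤ᵇ⇒≤ m n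
<ᵇT : ∀ {m n} → m < n → T (m <ᵇ n)
<ᵇT = <⇒<ᵇ
T<ᵇ : ∀ {m n} → T (m <ᵇ n) → m < n
T<ᵇ {m} {n} = <ᵇ⇒< m n
≡ᵇT : ∀ {m n} → m ≡ n → T (m ≡ᵇ n)
≡ᵇT {m} {n} = ≡⇒≡ᵇ m n
T≡ᵇ : ∀ {m n} → T (m ≡ᵇ n) → m ≡ n
T≡ᵇ {m} {n} = ≡ᵇ⇒≡ m n

≡ᵇ-refl : ∀ n → (n ≡ᵇ n) ≡ true
≡ᵇ-refl n = ≡true (≡ᵇT {n} refl)

≢⇒≡ᵇ≡false : ∀ {m n} → m ≢ n → (m ≡ᵇ n) ≡ false
≢⇒≡ᵇ≡false ne = Tfalse (λ t → ne (T≡ᵇ t))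

+≡⇒∸≡ : ∀ {s a b} → a + b ≡ s → s ∸ a ≡ b
+≡⇒∸≡ {s} {a} {b} e = trans (cong (_∸ a) (sym e)) (m+n∸m≡n a b)

sumFrom : (ℕ → ℕ) → ℕ → ℕ → ℕ
sumFrom g a zero = 0
sumFrom g a (suc n) = g a + sumFrom g (suc a) n

countFrom : (ℕ → Bool) → ℕ → ℕ → ℕ
countFrom f a n = sumFrom (λ x → δ (f x)) a n

sumFrom-cong : ∀ {g h} a n → (∀ x → a ≤ x → x < a + n → g x ≡ h x) → sumFrom g a n ≡ sumFrom h a n
sumFrom-cong a zero e = refl
sumFrom-cong {g} {h} a (suc n) e =
  cong₂ _+_ (e a ≤-refl (m<m+n a z<s))
    (sumFrom-cong (suc a) n (λ x p q → e x (<⇒≤ p) (subst (x <_) (sym (+-suc a n)) q)))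

countFrom-cong : ∀ {f g} a n → (∀ x → a ≤ x → x < a + n → f x ≡ g x) → countFrom f a n ≡ countFrom g a n
countFrom-cong a n e = sumFrom-cong a n (λ x p q → cong δ (e x p q))

sumFrom-split : ∀ g a n p → sumFrom g a (n + p) ≡ sumFrom g a n + sumFrom g (a + n) p
sumFrom-split g a zero p = cong (λ z → sumFrom g z p) (sym (+-identityʳ a))
sumFrom-split g a (suc n) p rewrite sumFrom-split g (suc a) n p | +-suc a n = sym (+-assoc (g a) _ _)

sumFrom-+ : ∀ g h a n → sumFrom (λ x → g x + h x) a n ≡ sumFrom g a n + sumFrom h a n
sumFrom-+ g h a zero = refl
sumFrom-+ g h a (suc n) rewrite sumFrom-+ g h (suc a) n = interchange (g a) (h a) (sumFrom g (suc a) n) (sumFrom h (suc a) n)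
  where
  interchange : ∀ p q r s → p + q + (r + s) ≡ p + r + (q + s)
  interchange = solve-∀

sumFrom-* : ∀ k g a n → sumFrom (λ x → k * g x) a n ≡ k * sumFrom g a n
sumFrom-* k g a zero = sym (*-zeroʳ k)
sumFrom-* k g a (suc n) rewrite sumFrom-* k g (suc a) n = sym (*-distribˡ-+ k (g a) _)

sumFrom-const : ∀ k a n → sumFrom (λ _ → k) a n ≡ n * k
sumFrom-const k a zero = refl
sumFrom-const k a (suc n) rewrite sumFrom-const k (suc a) n = refl

sumFrom-zero : ∀ {g} a n → (∀ x → a ≤ x → x < a + n → g x ≡ 0) → sumFrom g a n ≡ 0
sumFrom-zero {g} a n e = trans (sumFrom-cong a n e) (trans (sumFrom-const 0 a n) (*-zeroʳ n))

sumFrom-shift : ∀ g a n → sumFrom g (suc a) n ≡ sumFrom (λ x → g (suc x)) a n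
sumFrom-shift g a zero = refl
sumFrom-shift g a (suc n) rewrite sumFrom-shift g (suc a) n = refl

sumFrom-shift+ : ∀ g b a n → sumFrom g (b + a) n ≡ sumFrom (λ x → g (b + x)) a n
sumFrom-shift+ g zero a n = refl
sumFrom-shift+ g (suc b) a n =
  trans (sumFrom-shift g (b + a) n)
        (sumFrom-shift+ (λ x → g (suc x)) b a n)

sumFrom-single : ∀ {g} a n x₀ → a ≤ x₀ → x₀ < a + n → (∀ x → a ≤ x → x < a + n → x ≢ x₀ → g x ≡ 0)
           → sumFrom g a n ≡ g x₀
sumFrom-single {g} a zero x₀ p q e = ⊥-elim (<-irrefl refl (≤-trans q (subst (_≤ x₀) (sym (+-identityʳ a)) p)))
sumFrom-single {g} a (suc n) x₀ p q e with a ≟ x₀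
... | yes refl = trans (cong (g a +_) (sumFrom-zero (suc a) n (λ x r s → e x (≤-trans (n≤1+n a) r) (subst (x <_) (sym (+-suc a n)) s) (λ eq → <-irrefl (sym eq) r)))) (+-identityʳ (g a))
... | no a≢x₀ = trans (cong (_+ sumFrom g (suc a) n) (e a ≤-refl (m<m+n a z<s) a≢x₀))
                 (sumFrom-single (suc a) n x₀ (≤∧≢⇒< p a≢x₀) (subst (x₀ <_) (+-suc a n) q)
                   (λ x r s ne → e x (≤-trans (n≤1+n a) r) (subst (x <_) (sym (+-suc a n)) s) ne))

sumFrom-mono : ∀ {g h} a n → (∀ x → g x ≤ h x) → sumFrom g a n ≤ sumFrom h a n
sumFrom-mono a zero e = z≤n
sumFrom-mono a (suc n) e = +-mono-≤ (e a) (sumFrom-mono (suc a) n e)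

length-filter-∷ : ∀ (f : ℕ → Bool) x (xs : List ℕ) → length (filterᵇ f (x ∷ xs)) ≡ δ (f x) + length (filterᵇ f xs)
length-filter-∷ f x xs with f x
... | true = refl
... | false = refl

length-filter-applyUpTo : ∀ (f : ℕ → Bool) (g : ℕ → ℕ) n → length (filterᵇ f (applyUpTo g n)) ≡ countFrom (f ∘ g) 0 n
length-filter-applyUpTo f g zero = refl
length-filter-applyUpTo f g (suc n) =
  trans (length-filter-∷ f (g 0) (applyUpTo (g ∘ suc) n))
    (cong (δ (f (g 0)) +_) (trans (length-filter-applyUpTo f (g ∘ suc) n) (sym (sumFrom-shift (λ x → δ (f (g x))) 0 n))))

length-filter-upTo : ∀ f n → length (filterᵇ f (upTo n)) ≡ countFrom f 0 n
length-filter-upTo f n = length-filter-applyUpTo f (λ x → x) n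

sum-map-filter-∷ : ∀ (h : ℕ → ℕ) (f : ℕ → Bool) x (xs : List ℕ) → sum (map h (filterᵇ f (x ∷ xs))) ≡ (if f x then h x else 0) + sum (map h (filterᵇ f xs))
sum-map-filter-∷ h f x xs with f x
... | true = refl
... | false = refl

sum-map-filter-applyUpTo : ∀ (h : ℕ → ℕ) (f : ℕ → Bool) (g : ℕ → ℕ) n → sum (map h (filterᵇ f (applyUpTo g n))) ≡ sumFrom (λ x → if f (g x) then h (g x) else 0) 0 n
sum-map-filter-applyUpTo h f g zero = refl
sum-map-filter-applyUpTo h f g (suc n) =
  trans (sum-map-filter-∷ h f (g 0) (applyUpTo (g ∘ suc) n))
    (cong ((if f (g 0) then h (g 0) else 0) +_) (trans (sum-map-filter-applyUpTo h f (g ∘ suc) n) (sym (sumFrom-shift (λ x → if f (g x) then h (g x) else 0) 0 n))))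

sum-map-filter-upTo : ∀ (h : ℕ → ℕ) f n → sum (map h (filterᵇ f (upTo n))) ≡ sumFrom (λ x → if f x then h x else 0) 0 n
sum-map-filter-upTo h f n = sum-map-filter-applyUpTo h f (λ x → x) n

all-applyUpTo : ∀ (p : ℕ → Bool) (g : ℕ → ℕ) n → T (all p (applyUpTo g n)) → ∀ x → x < n → T (p (g x))
all-applyUpTo p g (suc n) h zero _ = T∧₁ h
all-applyUpTo p g (suc n) h (suc x) (s≤s q) = all-applyUpTo p (g ∘ suc) n (T∧₂ {p (g 0)} h) x q

all-applyUpTo⁻ : ∀ (p : ℕ → Bool) (g : ℕ → ℕ) n → (∀ x → x < n → T (p (g x))) → T (all p (applyUpTo g n))
all-applyUpTo⁻ p g zero h = tt
all-applyUpTo⁻ p g (suc n) h = T∧ (h 0 z<s) (all-applyUpTo⁻ p (g ∘ suc) n (λ x q → h (suc x) (s≤s q)))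

all-upTo : ∀ p n → T (all p (upTo n)) → ∀ x → x < n → T (p x)
all-upTo p n = all-applyUpTo p (λ x → x) n

all-upTo⁻ : ∀ p n → (∀ x → x < n → T (p x)) → T (all p (upTo n))
all-upTo⁻ p n = all-applyUpTo⁻ p (λ x → x) n

sumFrom-suc : ∀ g a n → sumFrom g a (suc n) ≡ sumFrom g a n + g (a + n)
sumFrom-suc g a n = trans (cong (sumFrom g a) (+-comm 1 n)) (trans (sumFrom-split g a n 1) (cong (sumFrom g a n +_) (+-identityʳ (g (a + n)))))

countFrom-suc : ∀ f n → countFrom f 0 (suc n) ≡ countFrom f 0 n + δ (f n)
countFrom-suc f n = sumFrom-suc (λ x → δ (f x)) 0 n

countFrom-suc-true : ∀ f n → T (f n) → countFrom f 0 (suc n) ≡ suc (countFrom f 0 n)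
countFrom-suc-true f n h = trans (countFrom-suc f n) (trans (cong (countFrom f 0 n +_) (δT h)) (+-comm (countFrom f 0 n) 1))

countFrom-suc-false : ∀ f n → ¬ T (f n) → countFrom f 0 (suc n) ≡ countFrom f 0 n
countFrom-suc-false f n h = trans (countFrom-suc f n) (trans (cong (countFrom f 0 n +_) (δF h)) (+-identityʳ _))

countFrom-mono : ∀ f {x y} → x ≤ y → countFrom f 0 x ≤ countFrom f 0 y
countFrom-mono f {x} {y} x≤y = subst (λ z → countFrom f 0 x ≤ countFrom f 0 z) (m+[n∸m]≡n x≤y)
  (subst (countFrom f 0 x ≤_) (sym (sumFrom-split (λ z → δ (f z)) 0 x (y ∸ x))) (m≤m+n _ _))

countFrom-mono-< : ∀ f {x y} → x < y → T (f x) → countFrom f 0 x < countFrom f 0 y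
countFrom-mono-< f {x} {y} x<y h = subst (_≤ countFrom f 0 y) (countFrom-suc-true f x h) (countFrom-mono f x<y)

countFrom-+-not : ∀ f a n → countFrom f a n + countFrom (λ x → not (f x)) a n ≡ n
countFrom-+-not f a zero = refl
countFrom-+-not f a (suc n) with f a
... | true = cong suc (countFrom-+-not f (suc a) n)
... | false = trans (+-suc (countFrom f (suc a) n) _) (cong suc (countFrom-+-not f (suc a) n))

countFrom-all-≥ : ∀ f a n → (∀ x → a ≤ x → T (f x)) → countFrom f a n ≡ n
countFrom-all-≥ f a zero h = refl
countFrom-all-≥ f a (suc n) h = cong₂ _+_ (δT (h a ≤-refl)) (countFrom-all-≥ f (suc a) n (λ x q → h x (≤-trans (n≤1+n a) q)))

countFrom-none : ∀ f a n → (∀ x → a ≤ x → x < a + n → ¬ T (f x)) → countFrom f a n ≡ 0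
countFrom-none f a n h = sumFrom-zero a n (λ x p q → δF (h x p q))

and5 : ∀ a b c d e → T (a ∧ b ∧ c ∧ d ∧ e) → T a × T b × T c × T d × T e
and5 true true true true true _ = tt , tt , tt , tt , tt

and5⁻ : ∀ {a b c d e} → T a → T b → T c → T d → T e → T (a ∧ b ∧ c ∧ d ∧ e)
and5⁻ {true} {true} {true} {true} {true} _ _ _ _ _ = tt

and4 : ∀ a b c d → T (a ∧ b ∧ c ∧ d) → T a × T b × T c × T d
and4 true true true true _ = tt , tt , tt , tt

and4⁻ : ∀ {a b c d} → T a → T b → T c → T d → T (a ∧ b ∧ c ∧ d)
and4⁻ {true} {true} {true} {true} _ _ _ _ = tt

and3 : ∀ a b c → T (a ∧ b ∧ c) → T a × T b × T c
and3 true true true _ = tt , tt , tt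

and3⁻ : ∀ {a b c} → T a → T b → T c → T (a ∧ b ∧ c)
and3⁻ {true} {true} {true} _ _ _ = tt

and2 : ∀ a b → T (a ∧ b) → T a × T b
and2 true true _ = tt , tt

all-counterexample : ∀ (p : ℕ → Bool) (g : ℕ → ℕ) n → ¬ T (all p (applyUpTo g n)) → Σ ℕ λ x → x < n × ¬ T (p (g x))
all-counterexample p g zero h = ⊥-elim (h tt)
all-counterexample p g (suc n) h with Tdec (p (g 0))
... | inj₂ q = 0 , s≤s z≤n , q
... | inj₁ q with all-counterexample p (g ∘ suc) n (λ t → h (T∧ q t))
...   | x , x<n , r = suc x , s≤s x<n , r

all-counterexample-upTo : ∀ (p : ℕ → Bool) n → ¬ T (all p (upTo n)) → Σ ℕ λ x → x < n × ¬ T (p x)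
all-counterexample-upTo p n = all-counterexample p (λ x → x) n

countFrom-≡ᵇ : ∀ p a n → countFrom (λ y → y ≡ᵇ p) a n ≡ δ ((a ≤ᵇ p) ∧ (p <ᵇ a + n))
countFrom-≡ᵇ p a n with a ≤? p | p <? a + n
... | yes ap | yes pn = trans (sumFrom-single a n p ap pn (λ x _ _ ne → δF (λ t → ne (T≡ᵇ t))))
                          (trans (cong δ (≡true (≡ᵇT {p} refl))) (sym (cong δ (trans (cong₂ _∧_ (≡true (≤ᵇT ap)) (≡true (<ᵇT pn))) refl))))
... | no ap | _ = trans (countFrom-none _ a n (λ x xa _ t → ap (subst (a ≤_) (T≡ᵇ t) xa))) (cong δ (sym (cong (_∧ (p <ᵇ a + n)) (Tfalse (λ t → ap (T≤ᵇ t))))))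
... | yes ap | no pn = trans (countFrom-none _ a n (λ x _ xn t → pn (subst (_< a + n) (T≡ᵇ t) xn)))
                          (cong δ (sym (trans (cong₂ _∧_ (≡true (≤ᵇT ap)) (Tfalse (λ t → pn (T<ᵇ t)))) refl)))

countFrom-≡ᵇ-∧ : ∀ p b a n → countFrom (λ y → (y ≡ᵇ p) ∧ b) a n ≡ δ (b ∧ (a ≤ᵇ p) ∧ (p <ᵇ a + n))
countFrom-≡ᵇ-∧ p true a n = trans (countFrom-cong a n (λ y _ _ → ∧-identityʳ (y ≡ᵇ p))) (countFrom-≡ᵇ p a n)
countFrom-≡ᵇ-∧ p false a n = countFrom-none _ a n (λ y _ _ t → ∧-false (y ≡ᵇ p) t)
  where
  ∧-false : ∀ b → ¬ T (b ∧ false)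
  ∧-false true ()
  ∧-false false ()

countFrom-all : ∀ f a n → (∀ x → a ≤ x → x < a + n → T (f x)) → countFrom f a n ≡ n
countFrom-all f a n h = trans (countFrom-cong {f} {λ _ → true} a n (λ x p q → ≡true (h x p q))) (countFrom-all-≥ (λ _ → true) a n (λ _ _ → tt))

-- A copy of the private scan computing the conductor in Defs.
conductorOf : (ℕ → Bool) → ℕ → ℕ
conductorOf M zero = 0
conductorOf M (suc n) = if M n then conductorOf M n else suc n

conductorOf-unique : (M : ℕ → Bool) (f : ℕ → ℕ) → f 0 ≡ 0 → (∀ n → f (suc n) ≡ (if M n then f n else suc n)) → ∀ n → f n ≡ conductorOf M n
conductorOf-unique M f e0 es zero = e0
conductorOf-unique M f e0 es (suc n) rewrite es n | conductorOf-unique M f e0 es n = refl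

conductor≡conductorOf : (R : Raw) → conductor R ≡ conductorOf (Raw.mem R) (Raw.bound R)
conductor≡conductorOf R with conductorOf-unique (Raw.mem R) _ refl (λ m → refl) | Raw.bound R
... | p | n = p n

conductorOf-mem : ∀ M b x → conductorOf M b ≤ x → x < b → T (M x)
conductorOf-mem M (suc b) x h q with M b in eq
... | true with m<1+n⇒m<n∨m≡n q
...   | inj₁ x<b = conductorOf-mem M b x h x<b
...   | inj₂ refl = subst T (sym eq) tt
conductorOf-mem M (suc b) x h q | false = ⊥-elim (<-irrefl refl (≤-trans q h))

conductorOf-gap : ∀ M b n → conductorOf M b ≡ suc n → ¬ T (M n)
conductorOf-gap M (suc b) n e with M b in eq
... | true = conductorOf-gap M b n e
... | false = λ t → false≢T t (subst (λ z → M z ≡ false) (suc-injective e) eq)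

applyUpTo-cong : ∀ {g h : ℕ → ℕ} n → (∀ x → g x ≡ h x) → applyUpTo g n ≡ applyUpTo h n
applyUpTo-cong zero e = refl
applyUpTo-cong (suc n) e = cong₂ _∷_ (e 0) (applyUpTo-cong n (λ x → e (suc x)))

filterᵇ-applyUpTo-true : ∀ p a n → p (a + 0) ≡ true →
  filterᵇ p (applyUpTo (a +_) (suc n)) ≡ (a + 0) ∷ filterᵇ p (applyUpTo ((a +_) ∘ suc) n)
filterᵇ-applyUpTo-true p a n q rewrite q = refl

filterᵇ-applyUpTo-false : ∀ p a n → p (a + 0) ≡ false →
  filterᵇ p (applyUpTo (a +_) (suc n)) ≡ filterᵇ p (applyUpTo ((a +_) ∘ suc) n)
filterᵇ-applyUpTo-false p a n q rewrite q = refl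

-- The list indexing function of Defs is private, so it is characterised by its two defining equations.
nth-filter : (f : List ℕ → ℕ → ℕ) → (∀ x xs → f (x ∷ xs) 0 ≡ x) → (∀ x xs i → f (x ∷ xs) (suc i) ≡ f xs i) →
   ∀ (p : ℕ → Bool) a n i → i < countFrom p a n →
   Σ ℕ λ d → f (filterᵇ p (applyUpTo (a +_) n)) i ≡ a + d × d < n × T (p (a + d)) × countFrom p a d ≡ i
nth-filter f e1 e2 p a zero i ()
nth-filter f e1 e2 p a (suc n) i h with p a in eq
nth-filter f e1 e2 p a (suc n) zero h | true =
  0 , trans (cong (λ L → f L 0) (filterᵇ-applyUpTo-true p a n pa0)) (e1 _ _) , z<s , subst T (sym pa0) tt , refl
  where
  pa0 = trans (cong p (+-identityʳ a)) eq
nth-filter f e1 e2 p a (suc n) (suc i) (s≤s h) | true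
  with nth-filter f e1 e2 p (suc a) n i h
... | d , e , d<n , t , ce =
  suc d ,
  trans (cong (λ L → f L (suc i)) (filterᵇ-applyUpTo-true p a n (trans (cong p (+-identityʳ a)) eq)))
    (trans (e2 _ _ _) (trans (cong (λ L → f L i) (cong (filterᵇ p) (applyUpTo-cong n (λ x → +-suc a x))))
      (trans e (sym (+-suc a d))))) ,
  s≤s d<n , subst (λ z → T (p z)) (sym (+-suc a d)) t , cong₂ _+_ (cong δ eq) ce
nth-filter f e1 e2 p a (suc n) i h | false
  with nth-filter f e1 e2 p (suc a) n i h
... | d , e , d<n , t , ce =
  suc d ,
  trans (cong (λ L → f L i) (filterᵇ-applyUpTo-false p a n (trans (cong p (+-identityʳ a)) eq)))
    (trans (cong (λ L → f L i) (cong (filterᵇ p) (applyUpTo-cong n (λ x → +-suc a x))))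
      (trans e (sym (+-suc a d)))) ,
  s≤s d<n , subst (λ z → T (p z)) (sym (+-suc a d)) t , trans (cong (_+ countFrom p (suc a) d) (cong δ eq)) ce

nth-filter-upTo : (f : List ℕ → ℕ → ℕ) → (∀ x xs → f (x ∷ xs) 0 ≡ x) → (∀ x xs i → f (x ∷ xs) (suc i) ≡ f xs i) →
   ∀ (p : ℕ → Bool) n i (L : List ℕ) → filterᵇ p (upTo n) ≡ L → i < countFrom p 0 n →
   Σ ℕ λ d → f L i ≡ d × d < n × T (p d) × countFrom p 0 d ≡ i
nth-filter-upTo f e1 e2 p n i L refl h with nth-filter f e1 e2 p 0 n i h
... | d , e , r = d , e , r

-- For q = λ_p and x ≥ c, a decomposition is what prevents x from being an order-p seed;
-- for q = 0 it is what prevents x from being primitive.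
Decomposition : (ℕ → Bool) → ℕ → ℕ → Set
Decomposition M q x = Σ ℕ λ a → Σ ℕ λ b → T (M a) × T (M b) × q < a × a ≤ b × b < x × a + b ≡ x + q

noDecomp : (ℕ → Bool) → ℕ → ℕ → Bool
noDecomp M q x = all (λ a → all (λ b → not ((q <ᵇ a) ∧ (a ≤ᵇ b) ∧ M a ∧ M b ∧ (a + b ≡ᵇ x + q))) (upTo x)) (upTo x)

noDecomp-sound : ∀ M q x → T (noDecomp M q x) → ¬ Decomposition M q x
noDecomp-sound M q x h (a , b , ma , mb , qa , ab , bx , e) =
  Tnot⁻ (all-upTo _ x (all-upTo _ x h a (≤-<-trans ab bx)) b bx)
    (and5⁻ (<ᵇT qa) (≤ᵇT ab) ma mb (≡ᵇT e))

noDecomp-complete : ∀ M q x → ¬ Decomposition M q x → T (noDecomp M q x)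
noDecomp-complete M q x h = all-upTo⁻ _ x (λ a a<x → all-upTo⁻ _ x (λ b b<x → Tnot (λ t → go a b b<x
  (and5 (q <ᵇ a) (a ≤ᵇ b) (M a) (M b) (a + b ≡ᵇ x + q) t))))
  where
  go : ∀ a b → b < x → T (q <ᵇ a) × T (a ≤ᵇ b) × T (M a) × T (M b) × T (a + b ≡ᵇ x + q) → ⊥
  go a b b<x (t1 , t2 , t3 , t4 , t5) = h (a , b , t3 , t4 , T<ᵇ t1 , T≤ᵇ t2 , b<x , T≡ᵇ t5)

noDecomp-false : ∀ M q x → Decomposition M q x → noDecomp M q x ≡ false
noDecomp-false M q x d = Tfalse (λ t → noDecomp-sound M q x t d)

-- The elements of a numerical semigroup

module Basics (Λ : NumericalSemigroup) where
  R : Raw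
  R = NumericalSemigroup.raw Λ
  M : ℕ → Bool
  M = Raw.mem R
  c : ℕ
  c = conductor R

  M-0 : T (M 0)
  M-0 = subst T (sym (NumericalSemigroup.mem-0 Λ)) tt

  M-+ : ∀ {a b} → T (M a) → T (M b) → T (M (a + b))
  M-+ {a} {b} p q = subst T (sym (NumericalSemigroup.mem-+ Λ a b (≡true p) (≡true q))) tt

  M-≥c : ∀ x → c ≤ x → T (M x)
  M-≥c x h with x <? Raw.bound R
  ... | yes x<b = conductorOf-mem M (Raw.bound R) x (subst (_≤ x) (conductor≡conductorOf R) h) x<b
  ... | no x≮b = subst T (sym (NumericalSemigroup.mem-cofinite Λ x (≮⇒≥ x≮b))) tt

  conductor-gap : ∀ n → c ≡ suc n → ¬ T (M n)
  conductor-gap n e = conductorOf-gap M (Raw.bound R) n (trans (sym (conductor≡conductorOf R)) e)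

  conductor-unique : ∀ d → (∀ x → d ≤ x → T (M x)) → (∀ n → d ≡ suc n → ¬ T (M n)) → c ≡ d
  conductor-unique d h1 h2 with <-cmp c d
  ... | tri≈ _ e _ = e
  ... | tri< c<d _ _ = ⊥-elim (h2 (pred d) (sym (suc-pred d {{>-nonZero (≤-<-trans z≤n c<d)}})) (M-≥c (pred d) (<⇒≤pred c<d)))
  ... | tri> _ _ d<c = ⊥-elim (conductor-gap (pred c) (sym (suc-pred c {{>-nonZero (≤-<-trans z≤n d<c)}})) (h1 (pred c) (<⇒≤pred d<c)))

  k : ℕ
  k = rank R

  genus≡count : genus R ≡ countFrom (λ n → not (M n)) 0 c
  genus≡count = length-filter-upTo _ c

  rank≡count : k ≡ countFrom M 0 c
  rank≡count = trans (cong (c ∸_) genus≡count) (trans (cong (_∸ countFrom (λ n → not (M n)) 0 c) (sym (countFrom-+-not M 0 c))) (m+n∸n≡m (countFrom M 0 c) (countFrom (λ n → not (M n)) 0 c)))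

  count-c+ : ∀ n → countFrom M 0 (c + n) ≡ k + n
  count-c+ n = trans (sumFrom-split _ 0 c n) (cong₂ _+_ (sym rank≡count) (countFrom-all-≥ M c n M-≥c))

  elt-info : ∀ i → T (M (elt R i)) × countFrom M 0 (elt R i) ≡ i
  elt-info with nth-filter-upTo _ (λ x xs → refl) (λ x xs i → refl)
  ... | G = aux
    where
    aux : ∀ i → T (M (elt R i)) × countFrom M 0 (elt R i) ≡ i
    aux i with Data.List.filter (λ x → T? (M x)) (applyUpTo (λ x → x) (c + suc i)) in eq
    ... | L with G M (c + suc i) i L eq (subst (i <_) (sym (count-c+ (suc i))) (≤-trans (n<1+n i) (m≤n+m (suc i) k)))
    ...   | d , e , _ , t , ce = subst (λ z → T (M z) × countFrom M 0 z ≡ i) (sym e) (t , ce)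

  elt-mem : ∀ i → T (M (elt R i))
  elt-mem i = proj₁ (elt-info i)

  count-elt : ∀ i → countFrom M 0 (elt R i) ≡ i
  count-elt i = proj₂ (elt-info i)

  count-injective : ∀ {x y} → T (M x) → T (M y) → countFrom M 0 x ≡ countFrom M 0 y → x ≡ y
  count-injective {x} {y} mx my e with <-cmp x y
  ... | tri≈ _ q _ = q
  ... | tri< x<y _ _ = ⊥-elim (<-irrefl e (countFrom-mono-< M x<y mx))
  ... | tri> _ _ y<x = ⊥-elim (<-irrefl (sym e) (countFrom-mono-< M y<x my))

  elt-count : ∀ {x} → T (M x) → elt R (countFrom M 0 x) ≡ x
  elt-count {x} mx = count-injective (elt-mem _) mx (count-elt _)

  elt-mono-< : ∀ {i j} → i < j → elt R i < elt R j
  elt-mono-< {i} {j} i<j with <-cmp (elt R i) (elt R j)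
  ... | tri< p _ _ = p
  ... | tri≈ _ q _ = ⊥-elim (<-irrefl (trans (sym (count-elt i)) (trans (cong (countFrom M 0) q) (count-elt j))) i<j)
  ... | tri> _ _ q = ⊥-elim (<-asym i<j (subst₂ _<_ (count-elt j) (count-elt i) (countFrom-mono-< M q (elt-mem j))))

  elt-mono-≤ : ∀ {i j} → i ≤ j → elt R i ≤ elt R j
  elt-mono-≤ {i} {j} i≤j with m≤n⇒m<n∨m≡n i≤j
  ... | inj₁ p = <⇒≤ (elt-mono-< p)
  ... | inj₂ refl = ≤-refl

  elt-cancel-< : ∀ {i j} → elt R i < elt R j → i < j
  elt-cancel-< {i} {j} p = subst₂ _<_ (count-elt i) (count-elt j) (countFrom-mono-< M p (elt-mem i))

  elt-0 : elt R 0 ≡ 0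
  elt-0 = elt-count M-0

  elt<conductor : ∀ i → i < k → elt R i < c
  elt<conductor i i<k with <-cmp (elt R i) c
  ... | tri< p _ _ = p
  ... | tri≈ _ q _ = ⊥-elim (<-irrefl (trans (sym (count-elt i)) (trans (cong (countFrom M 0) q) (sym rank≡count))) i<k)
  ... | tri> _ _ q = ⊥-elim (<-asym i<k (subst₂ _<_ (sym rank≡count) (count-elt i) (countFrom-mono-< M q (M-≥c c ≤-refl))))

  elt-rank : elt R k ≡ c
  elt-rank = trans (cong (elt R) rank≡count) (elt-count (M-≥c c ≤-refl))

  elt-next : ∀ i x → T (M x) → elt R i < x → elt R (suc i) ≤ x
  elt-next i x mx p with <-cmp (elt R (suc i)) x
  ... | tri< q _ _ = <⇒≤ q
  ... | tri≈ _ q _ = ≤-reflexive q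
  ... | tri> _ _ q = ⊥-elim (<-irrefl refl (≤-trans (subst (_< countFrom M 0 x) (count-elt i) (countFrom-mono-< M p (elt-mem i)))
                       (subst (countFrom M 0 x ≤_) (cong pred (count-elt (suc i))) (<⇒≤pred (countFrom-mono-< M q mx)))))

  count-between : ∀ j y → elt R j ≤ y → y < elt R (suc j) → countFrom M 0 (suc y) ≡ suc j
  count-between j y p q = ≤-antisym
    (subst (countFrom M 0 (suc y) ≤_) (count-elt (suc j)) (countFrom-mono M q))
    (subst (_≤ countFrom M 0 (suc y)) (trans (countFrom-suc-true M (elt R j) (elt-mem j)) (cong suc (count-elt j))) (countFrom-mono M (s≤s p)))

  index≡count : ∀ x → index R x ≡ countFrom M 0 x
  index≡count x = length-filter-upTo M x

  isSeed-sound : ∀ p x → T (isSeed R p x) → p < k × T (M x) × c ≤ x × ¬ Decomposition M (elt R p) x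
  isSeed-sound p x h with and4 (p <ᵇ rank R) (M x) (c ≤ᵇ x) _ h
  ... | t1 , t2 , t3 , t4 = T<ᵇ t1 , t2 , T≤ᵇ t3 , nd
    where
    s = index R x
    s≡ : s ≡ countFrom M 0 x
    s≡ = index≡count x
    nd : ¬ Decomposition M (elt R p) x
    nd (a , b , ma , mb , pa , ab , bx , e) =
      Tnot⁻ (all-upTo _ s (all-upTo _ s t4 i i<s) j j<s)
        (and3⁻ (<ᵇT (elt-cancel-< (subst (elt R p <_) (sym (elt-count ma)) pa))) (≤ᵇT (countFrom-mono M ab))
           (≡ᵇT (trans (cong (λ z → elt R z + elt R p) s≡) (trans (cong (_+ elt R p) (elt-count t2))
              (trans (sym e) (sym (cong₂ _+_ (elt-count ma) (elt-count mb))))))))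
      where
      i = countFrom M 0 a
      j = countFrom M 0 b
      j<s : j < s
      j<s = subst (j <_) (sym s≡) (countFrom-mono-< M bx mb)
      i<s : i < s
      i<s = ≤-<-trans (countFrom-mono M ab) j<s

  isSeed-complete : ∀ p x → p < k → T (M x) → c ≤ x → ¬ Decomposition M (elt R p) x → T (isSeed R p x)
  isSeed-complete p x pk mx cx nd = and4⁻ (<ᵇT pk) mx (≤ᵇT cx)
    (all-upTo⁻ _ s (λ i i<s → all-upTo⁻ _ s (λ j j<s → Tnot (λ t → go i j j<s (and3 (p <ᵇ i) (i ≤ᵇ j) _ t)))))
    where
    s = index R x
    s≡ : s ≡ countFrom M 0 x
    s≡ = index≡count x
    go : ∀ i j → j < s → T (p <ᵇ i) × T (i ≤ᵇ j) × T (elt R s + elt R p ≡ᵇ elt R i + elt R j) → ⊥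
    go i j j<s (t1 , t2 , t3) = nd (elt R i , elt R j , elt-mem i , elt-mem j , elt-mono-< (T<ᵇ t1) , elt-mono-≤ (T≤ᵇ t2) ,
       subst (elt R j <_) (trans (cong (elt R) s≡) (elt-count mx)) (elt-mono-< j<s) ,
       trans (sym (T≡ᵇ t3)) (cong (_+ elt R p) (trans (cong (elt R) s≡) (elt-count mx))))

  seedStream-at : ∀ i j → i < c → elt R j ≤ i → i < elt R (suc j) → seedStream R i ≡ isSeed R j (c + i ∸ elt R j)
  seedStream-at i j i<c p q = trans (step (≡true (<ᵇT i<c))) (cong (λ z → isSeed R z (c + i ∸ elt R z)) jeq)
    where
    j' = length (filterᵇ M (upTo (suc i))) ∸ 1
    step : (i <ᵇ c) ≡ true → seedStream R i ≡ isSeed R j' (c + i ∸ elt R j')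
    step e rewrite e = refl
    jeq : j' ≡ j
    jeq = cong (_∸ 1) (trans (length-filter-upTo M (suc i)) (count-between j i p q))

  M-without : ℕ → ℕ → Bool
  M-without x z = M z ∧ not (z ≡ᵇ x)

  Primitive : ℕ → Set
  Primitive x = x ≢ 0 × T (M x) × ¬ Decomposition M 0 x

  isPrimitive-sound : ∀ x → T (isPrimitive R x) → Primitive x
  isPrimitive-sound x h with and3 (not (x ≡ᵇ 0)) (M x) _ h
  ... | t1 , t2 , t3 = (λ e → Tnot⁻ t1 (≡ᵇT e)) , t2 , nd
    where
    nd : ¬ Decomposition M 0 x
    nd (a , b , ma , mb , pa , ab , bx , e) = Tnot⁻ (all-upTo _ x t3 a a<x)
       (and4⁻ (≤ᵇT pa) (≤ᵇT (subst (1 ≤_) (sym b≡) (≤-trans pa ab))) ma (subst (λ z → T (M z)) (sym b≡) mb))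
      where
      a<x : a < x
      a<x = ≤-<-trans ab bx
      b≡ : x ∸ a ≡ b
      b≡ = trans (cong (_∸ a) (trans (sym (+-identityʳ x)) (sym e))) (m+n∸m≡n a b)

  isPrimitive-complete : ∀ x → Primitive x → T (isPrimitive R x)
  isPrimitive-complete x (x≢0 , mx , nd) = and3⁻ (Tnot (λ t → x≢0 (T≡ᵇ t))) mx
    (all-upTo⁻ _ x (λ a a<x → Tnot (λ t → go a a<x (and4 (1 ≤ᵇ a) (1 ≤ᵇ (x ∸ a)) (M a) (M (x ∸ a)) t))))
    where
    go : ∀ a → a < x → T (1 ≤ᵇ a) × T (1 ≤ᵇ (x ∸ a)) × T (M a) × T (M (x ∸ a)) → ⊥
    go a a<x (t1 , t2 , t3 , t4) with ≤-total a (x ∸ a)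
    ... | inj₁ le = nd (a , x ∸ a , t3 , t4 , T≤ᵇ t1 , le , ∸-<  , trans (m+[n∸m]≡n (<⇒≤ a<x)) (sym (+-identityʳ x)))
      where
      ∸-< : x ∸ a < x
      ∸-< = ∸-monoʳ-< (T≤ᵇ t1) (<⇒≤ a<x)
    ... | inj₂ le = nd (x ∸ a , a , t4 , t3 , T≤ᵇ t2 , le , a<x , trans (m∸n+n≡m (<⇒≤ a<x)) (sym (+-identityʳ x)))

  RightGen : ℕ → Set
  RightGen x = c ≤ x × Primitive x

  isRightGen-sound : ∀ x → T (isRightGen R x) → RightGen x
  isRightGen-sound x h with and2 (isPrimitive R x) (c ≤ᵇ x) h
  ... | t1 , t2 = T≤ᵇ t2 , isPrimitive-sound x t1

  isRightGen-complete : ∀ x → RightGen x → T (isRightGen R x)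
  isRightGen-complete x (cx , p) = T∧ (isPrimitive-complete x p) (≤ᵇT cx)

  m : ℕ
  m = elt R 1

  m>0 : 0 < m
  m>0 = subst (_< m) elt-0 (elt-mono-< (s≤s z≤n))

  M-m : T (M m)
  M-m = elt-mem 1

  m-minimal : ∀ x → T (M x) → x ≢ 0 → m ≤ x
  m-minimal x mx x≢0 = elt-next 0 x mx (subst (_< x) (sym elt-0) (n≢0⇒n>0 x≢0))

  m≤c : 1 ≤ c → m ≤ c
  m≤c h = m-minimal c (M-≥c c ≤-refl) (λ e → <-irrefl (sym e) h)

  decomposition-≥c+m : 1 ≤ c → ∀ x → c + m ≤ x → Decomposition M 0 x
  decomposition-≥c+m h x le = m , x ∸ m , M-m , M-≥c (x ∸ m) c≤x-m , m>0 , ≤-trans (m≤c h) c≤x-m ,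
      ∸-monoʳ-< m>0 (≤-trans (m≤n+m m c) le) , trans (m+[n∸m]≡n (≤-trans (m≤n+m m c) le)) (sym (+-identityʳ x))
    where
    c≤x-m : c ≤ x ∸ m
    c≤x-m = subst (_≤ x ∸ m) (m+n∸n≡m c m) (∸-monoˡ-≤ m le)

  rightGen<c+m : 1 ≤ c → ∀ x → RightGen x → x < c + m
  rightGen<c+m h x (_ , _ , _ , nd) with x <? c + m
  ... | yes p = p
  ... | no p = ⊥-elim (nd (decomposition-≥c+m h x (≮⇒≥ p)))

  rg? : ℕ → Bool
  rg? = isRightGen R

  nGens : ℕ
  nGens = countFrom rg? c m

  sumFrom-restrict-rightGens : 1 ≤ c → ∀ (h : ℕ → ℕ) → (∀ x → ¬ T (rg? x) → h x ≡ 0) → sumFrom h 0 (suc (c + m)) ≡ sumFrom h c m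
  sumFrom-restrict-rightGens hc h hz = begin
      sumFrom h 0 (suc (c + m)) ≡⟨ cong (sumFrom h 0) (trans (cong suc (+-comm c m)) (+-comm (suc m) c)) ⟩
      sumFrom h 0 (c + suc m) ≡⟨ sumFrom-split _ 0 c (suc m) ⟩
      sumFrom h 0 c + sumFrom h c (suc m) ≡⟨ cong₂ _+_ z1 (trans (cong (sumFrom h c) (+-comm 1 m)) (sumFrom-split _ c m 1)) ⟩
      0 + (sumFrom h c m + sumFrom h (c + m) 1) ≡⟨ cong (sumFrom h c m +_) z2 ⟩
      sumFrom h c m + 0 ≡⟨ +-identityʳ _ ⟩
      sumFrom h c m ∎
    where
    open ≡-Reasoning
    z1 : sumFrom h 0 c ≡ 0
    z1 = sumFrom-zero 0 c (λ x _ x<c → hz x (λ t → <-irrefl refl (≤-<-trans (proj₁ (isRightGen-sound x t)) x<c)))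
    z2 : sumFrom h (c + m) 1 ≡ 0
    z2 = sumFrom-zero (c + m) 1 (λ x p _ → hz x (λ t → <-irrefl refl (≤-<-trans p (rightGen<c+m hc x (isRightGen-sound x t)))))

  nChildren≡nGens : 1 ≤ c → nChildren R ≡ nGens
  nChildren≡nGens h = trans (length-filter-upTo rg? (suc (c + m))) (sumFrom-restrict-rightGens h (λ x → δ (rg? x)) (λ x → δF))

  countFrom-rightGens-tail : 1 ≤ c → ∀ (f : ℕ → Bool) → (∀ x → T (f x) → RightGen x) → ∀ a n → a ≤ c + m → c + m ≤ a + n → countFrom f a n ≡ countFrom f a (c + m ∸ a)
  countFrom-rightGens-tail h f hf a n p q = begin
      countFrom f a n ≡⟨ cong (countFrom f a) (sym (m+[n∸m]≡n q')) ⟩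
      countFrom f a ((c + m ∸ a) + (n ∸ (c + m ∸ a))) ≡⟨ sumFrom-split _ a (c + m ∸ a) _ ⟩
      countFrom f a (c + m ∸ a) + countFrom f (a + (c + m ∸ a)) (n ∸ (c + m ∸ a)) ≡⟨ cong (countFrom f a (c + m ∸ a) +_) z ⟩
      countFrom f a (c + m ∸ a) + 0 ≡⟨ +-identityʳ _ ⟩
      countFrom f a (c + m ∸ a) ∎
    where
    open ≡-Reasoning
    q' : c + m ∸ a ≤ n
    q' = subst (c + m ∸ a ≤_) (m+n∸m≡n a n) (∸-monoˡ-≤ a q)
    z : countFrom f (a + (c + m ∸ a)) (n ∸ (c + m ∸ a)) ≡ 0
    z = countFrom-none f (a + (c + m ∸ a)) (n ∸ (c + m ∸ a)) (λ x r _ t → <-irrefl refl (≤-<-trans (subst (_≤ x) (m+[n∸m]≡n p) r) (rightGen<c+m h x (hf x t))))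

  seedGen? : ℕ → Bool
  seedGen? x = rg? x ∧ noDecomp M m x

  nSeedGens : ℕ
  nSeedGens = countFrom seedGen? c m

  gensAbove : ℕ → ℕ
  gensAbove x = countFrom rg? (suc x) (c + m ∸ suc x)

  m-suc : Σ ℕ λ m0 → m ≡ suc m0
  m-suc with m | m>0
  ... | suc m0 | _ = m0 , refl

  if-not-rightGen : ∀ (g : ℕ → ℕ) x → ¬ T (rg? x) → (if rg? x then g x else 0) ≡ 0
  if-not-rightGen g x h with rg? x
  ... | true = ⊥-elim (h tt)
  ... | false = refl

noDecomp-witness : ∀ M q x → ¬ T (noDecomp M q x) → Decomposition M q x
noDecomp-witness M q x h with all-counterexample-upTo _ x h
... | a , a<x , h2 with all-counterexample-upTo _ x h2
...   | b , b<x , h3 with and5 (q <ᵇ a) (a ≤ᵇ b) (M a) (M b) (a + b ≡ᵇ x + q) (Tnot-inv h3)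
  where
  Tnot-inv : ∀ {z} → ¬ T (not z) → T z
  Tnot-inv {true} _ = tt
  Tnot-inv {false} f = ⊥-elim (f tt)
...     | t1 , t2 , t3 , t4 , t5 = a , b , t3 , t4 , T<ᵇ t1 , T≤ᵇ t2 , b<x , T≡ᵇ t5

-- The child Λ ∖ {μ}

module Child (Λ : NumericalSemigroup) (μ : ℕ) (hμ : T (isRightGen (NumericalSemigroup.raw Λ) μ)) where
  open Basics Λ

  rgμ : RightGen μ
  rgμ = isRightGen-sound μ hμ

  μ≢0 : μ ≢ 0
  μ≢0 = proj₁ (proj₂ rgμ)

  ndμ : ¬ Decomposition M 0 μ
  ndμ = proj₂ (proj₂ (proj₂ rgμ))

  M'-intro : ∀ {x} → T (M x) → x ≢ μ → T (M x ∧ not (x ≡ᵇ μ))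
  M'-intro mx ne = T∧ mx (Tnot (λ t → ne (T≡ᵇ t)))

  M'₁ : ∀ {x} → T (M x ∧ not (x ≡ᵇ μ)) → T (M x)
  M'₁ {x} t = proj₁ (and2 (M x) _ t)

  M'₂ : ∀ {x} → T (M x ∧ not (x ≡ᵇ μ)) → x ≢ μ
  M'₂ {x} t e = Tnot⁻ (proj₂ (and2 (M x) _ t)) (≡ᵇT e)

  private
    sum≢μ : ∀ a b → T (M (suc a)) → T (M (suc b)) → suc a + suc b ≢ μ
    sum≢μ a b ma mb e with ≤-total (suc a) (suc b)
    ... | inj₁ le = ndμ (suc a , suc b , ma , mb , s≤s z≤n , le , subst (suc b <_) e (m<n+m (suc b) (s≤s z≤n)) , trans e (sym (+-identityʳ μ)))
    ... | inj₂ le = ndμ (suc b , suc a , mb , ma , s≤s z≤n , le , subst (suc a <_) (trans (+-comm (suc b) (suc a)) e) (m<n+m (suc a) (s≤s z≤n)) , trans (+-comm (suc b) (suc a)) (trans e (sym (+-identityʳ μ))))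

  Λ' : NumericalSemigroup
  Λ' = record
    { raw = remove R μ
    ; mem-0 = ≡true (M'-intro M-0 (λ e → μ≢0 (sym e)))
    ; mem-+ = λ a b p q → ≡true (M'-intro (M-+ (M'₁ (subst T (sym p) tt)) (M'₁ (subst T (sym q) tt)))
                 (sum≢μ' a b (subst T (sym p) tt) (subst T (sym q) tt)))
    ; mem-cofinite = λ n le → ≡true (M'-intro (subst T (sym (NumericalSemigroup.mem-cofinite Λ n (≤-trans (m≤m⊔n _ _) le))) tt)
                 (λ e → <-irrefl (sym e) (≤-trans (m≤n⊔m _ _) le)))
    }
    where
    sum≢μ' : ∀ a b → T (M a ∧ not (a ≡ᵇ μ)) → T (M b ∧ not (b ≡ᵇ μ)) → a + b ≢ μ
    sum≢μ' zero b p q e = M'₂ q e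
    sum≢μ' (suc a) zero p q e = M'₂ p (trans (sym (+-identityʳ (suc a))) e)
    sum≢μ' (suc a) (suc b) p q e = sum≢μ a b (M'₁ p) (M'₁ q) e

  module S' = Basics Λ'

  cμ : c ≤ μ
  cμ = proj₁ rgμ

  conductor' : S'.c ≡ suc μ
  conductor' = S'.conductor-unique (suc μ)
    (λ x le → M'-intro (M-≥c x (≤-trans cμ (≤-trans (n≤1+n μ) le))) (λ e → <-irrefl (sym e) le))
    (λ n e t → M'₂ t (sym (suc-injective e)))

  M'-below : ∀ y → y < μ → S'.M y ≡ M y
  M'-below y y<μ = bool-ext M'₁ (λ t → M'-intro t (λ e → <-irrefl e y<μ))

  count'-below : ∀ x → x ≤ μ → countFrom S'.M 0 x ≡ countFrom M 0 x
  count'-below x x≤μ = countFrom-cong 0 x (λ y _ y<x → M'-below y (<-≤-trans y<x x≤μ))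

  elt'-below : ∀ i → elt R i < μ → elt S'.R i ≡ elt R i
  elt'-below i p = trans (cong (elt S'.R) (sym (trans (count'-below (elt R i) (<⇒≤ p)) (count-elt i))))
                      (S'.elt-count (M'-intro (elt-mem i) (λ e → <-irrefl e p)))

  rank' : S'.k ≡ countFrom M 0 μ
  rank' = trans S'.rank≡count (trans (cong (countFrom S'.M 0) conductor')
         (trans (countFrom-suc-false S'.M μ (λ t → M'₂ t refl)) (count'-below μ ≤-refl)))

  rank≤rank' : k ≤ S'.k
  rank≤rank' = subst₂ _≤_ (sym rank≡count) (sym rank') (countFrom-mono M cμ)

  decomposition'⇒ : ∀ q x → Decomposition S'.M q x → Decomposition M q x
  decomposition'⇒ q x (a , b , ma , mb , r) = a , b , M'₁ ma , M'₁ mb , r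

  module _ (m<μ : m < μ) where

    m'≡m : S'.m ≡ m
    m'≡m = elt'-below 1 m<μ

    rightGen'⇒rightGen : ∀ x → x < μ + m → S'.RightGen x → RightGen x
    rightGen'⇒rightGen x x< (c'≤x , x≢0 , mx , nd') = ≤-trans cμ (≤-trans (n≤1+n μ) (subst (_≤ x) conductor' c'≤x)) , x≢0 , M'₁ mx , nd
      where
      nd : ¬ Decomposition M 0 x
      nd (a , b , ma , mb , pa , ab , bx , e) with a ≟ μ | b ≟ μ
      ... | no a≢ | no b≢ = nd' (a , b , M'-intro ma a≢ , M'-intro mb b≢ , pa , ab , bx , e)
      ... | yes refl | _ = <-irrefl refl (<-≤-trans (+-cancelˡ-< μ b m (subst (_< μ + m) (sym (trans e (+-identityʳ x))) x<)) (≤-trans (<⇒≤ m<μ) ab))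
      ... | no _ | yes refl = <-irrefl refl (<-≤-trans (+-cancelʳ-< μ a m (subst (_< m + μ) (sym (trans e (+-identityʳ x))) (subst (x <_) (+-comm μ m) x<)))
                                  (m-minimal a ma (λ e0 → <-irrefl (sym e0) pa)))

    rightGen⇒rightGen' : ∀ x → suc μ ≤ x → RightGen x → S'.RightGen x
    rightGen⇒rightGen' x le (_ , x≢0 , mx , nd) = subst (_≤ x) (sym conductor') le , x≢0 , M'-intro mx (λ e → <-irrefl (sym e) le) , (λ d → nd (decomposition'⇒ 0 x d))

    rightGen'-top⇒ : S'.RightGen (μ + m) → ¬ Decomposition M m μ
    rightGen'-top⇒ (_ , _ , _ , nd') (a , b , ma , mb , pa , ab , bμ , e) =
      nd' (a , b , M'-intro ma (λ q → <-irrefl q (≤-<-trans ab bμ)) , M'-intro mb (λ q → <-irrefl q bμ) , ≤-<-trans z≤n pa , ab ,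
           <-≤-trans bμ (m≤m+n μ m) , trans e (sym (+-identityʳ (μ + m))))

    ⇒rightGen'-top : ¬ Decomposition M m μ → S'.RightGen (μ + m)
    ⇒rightGen'-top nd = subst (_≤ μ + m) (sym conductor') (subst (_≤ μ + m) (+-comm μ 1) (+-monoʳ-≤ μ m>0)) ,
        (λ e → <-irrefl (sym e) (≤-trans m>0 (m≤n+m m μ))) ,
        M'-intro (M-≥c (μ + m) (≤-trans cμ (m≤m+n μ m))) (λ e → <-irrefl (sym e) (subst (_< μ + m) (+-identityʳ μ) (+-monoʳ-< μ m>0))) ,
        nd'
      where
      nd' : ¬ Decomposition S'.M 0 (μ + m)
      nd' (a , b , ma , mb , pa , ab , bx , e) with m-minimal a (M'₁ ma) (λ e0 → <-irrefl (sym e0) pa)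
      ... | ma≤ with m≤n⇒m<n∨m≡n ma≤
      ...   | inj₂ refl = M'₂ mb (+-cancelˡ-≡ m b μ (trans e (trans (+-identityʳ (μ + m)) (+-comm μ m))))
      ...   | inj₁ m<a = nd (a , b , M'₁ ma , M'₁ mb , m<a , ab ,
                           +-cancelʳ-< a b μ (subst (_< μ + a) (sym (trans (+-comm b a) (trans e (+-identityʳ _)))) (+-monoʳ-< μ m<a)) ,
                           trans e (+-identityʳ _))

    module _ (c≥1 : 1 ≤ c) where

      μ<cm : μ < c + m
      μ<cm = rightGen<c+m c≥1 μ rgμ

      m0 : ℕ
      m0 = proj₁ m-suc
      em : m ≡ suc m0
      em = proj₂ m-suc

      top≡ : suc μ + m0 ≡ μ + m
      top≡ = trans (sym (+-suc μ m0)) (cong (μ +_) (sym em))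

      split' : ∀ f → countFrom f (suc μ) m ≡ countFrom f (suc μ) m0 + δ (f (μ + m))
      split' f = trans (cong (countFrom f (suc μ)) em) (trans (sumFrom-suc _ (suc μ) m0) (cong (λ z → countFrom f (suc μ) m0 + δ (f z)) top≡))

      rg'≡rg : ∀ x → suc μ ≤ x → x < suc μ + m0 → S'.rg? x ≡ rg? x
      rg'≡rg x le lt = bool-ext (λ t → isRightGen-complete x (rightGen'⇒rightGen x (subst (x <_) top≡ lt) (S'.isRightGen-sound x t)))
                               (λ t → S'.isRightGen-complete x (rightGen⇒rightGen' x le (isRightGen-sound x t)))

      rg'-top≡ : S'.rg? (μ + m) ≡ noDecomp M m μ
      rg'-top≡ = bool-ext (λ t → noDecomp-complete M m μ (rightGen'-top⇒ (S'.isRightGen-sound _ t))) (λ t → S'.isRightGen-complete _ (⇒rightGen'-top (noDecomp-sound M m μ t)))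

      cm≤ : c + m ≤ suc μ + m0
      cm≤ = subst (c + m ≤_) (sym top≡) (+-monoˡ-≤ m cμ)

      nGens'≡ : S'.nGens ≡ gensAbove μ + δ (noDecomp M m μ)
      nGens'≡ = begin
          S'.nGens ≡⟨ cong₂ (countFrom S'.rg?) conductor' m'≡m ⟩
          countFrom S'.rg? (suc μ) m ≡⟨ split' S'.rg? ⟩
          countFrom S'.rg? (suc μ) m0 + δ (S'.rg? (μ + m)) ≡⟨ cong₂ _+_ (countFrom-cong (suc μ) m0 rg'≡rg) (cong δ rg'-top≡) ⟩
          countFrom rg? (suc μ) m0 + δ (noDecomp M m μ) ≡⟨ cong (_+ δ (noDecomp M m μ)) (countFrom-rightGens-tail c≥1 rg? isRightGen-sound (suc μ) m0 μ<cm cm≤) ⟩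
          gensAbove μ + δ (noDecomp M m μ) ∎
        where open ≡-Reasoning

      nSeedGens'≡ : S'.nSeedGens ≡ countFrom (λ x → rg? x ∧ noDecomp S'.M m x) (suc μ) (c + m ∸ suc μ) + δ (noDecomp M m μ ∧ noDecomp S'.M m (μ + m))
      nSeedGens'≡ = begin
          S'.nSeedGens ≡⟨ cong₂ (countFrom S'.seedGen?) conductor' m'≡m ⟩
          countFrom S'.seedGen? (suc μ) m ≡⟨ split' S'.seedGen? ⟩
          countFrom S'.seedGen? (suc μ) m0 + δ (S'.seedGen? (μ + m)) ≡⟨ cong₂ _+_ (countFrom-cong (suc μ) m0 (λ x le lt → cong₂ _∧_ (rg'≡rg x le lt) (cong (λ z → noDecomp S'.M z x) m'≡m)))
                                                           (cong δ (cong₂ _∧_ rg'-top≡ (cong (λ z → noDecomp S'.M z (μ + m)) m'≡m))) ⟩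
          countFrom f (suc μ) m0 + δ (noDecomp M m μ ∧ noDecomp S'.M m (μ + m)) ≡⟨ cong (_+ δ (noDecomp M m μ ∧ noDecomp S'.M m (μ + m))) (countFrom-rightGens-tail c≥1 f hf (suc μ) m0 μ<cm cm≤) ⟩
          countFrom f (suc μ) (c + m ∸ suc μ) + δ (noDecomp M m μ ∧ noDecomp S'.M m (μ + m)) ∎
        where
        open ≡-Reasoning
        f : ℕ → Bool
        f x = rg? x ∧ noDecomp S'.M m x
        hf : ∀ x → T (f x) → RightGen x
        hf x t = isRightGen-sound x (proj₁ (and2 (rg? x) _ t))

-- Counting descendants

C2-suc : ∀ n → suc n C 2 ≡ n + n C 2
C2-suc n = trans (sym (nCk+nC[k+1]≡[n+1]C[k+1] n 1)) (cong (_+ n C 2) (nC1≡n n))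

C3-suc : ∀ n → suc n C 3 ≡ n C 2 + n C 3
C3-suc n = sym (nCk+nC[k+1]≡[n+1]C[k+1] n 2)

countAbove : (ℕ → Bool) → ℕ → ℕ → ℕ → ℕ
countAbove f a n x = countFrom f (suc x) (a + n ∸ suc x)

countAbove-suc : ∀ f a n x → countAbove f a (suc n) x ≡ countAbove f (suc a) n x
countAbove-suc f a n x = cong (λ z → countFrom f (suc x) (z ∸ suc x)) (+-suc a n)

countAbove-start : ∀ f a n → countAbove f a n a ≡ countFrom f (suc a) (n ∸ 1)
countAbove-start f a zero = cong (countFrom f (suc a)) (n∸n≡0' a)
  where
  n∸n≡0' : ∀ a → a + 0 ∸ suc a ≡ 0
  n∸n≡0' a = m≤n⇒m∸n≡0 (subst (_≤ suc a) (sym (+-identityʳ a)) (n≤1+n a))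
countAbove-start f a (suc n) = cong (countFrom f (suc a)) (trans (cong (_∸ suc a) (+-suc a n)) (m+n∸m≡n (suc a) n))

sumFrom-countAbove : ∀ f a n → sumFrom (λ x → if f x then countAbove f a n x else 0) a n ≡ countFrom f a n C 2
sumFrom-countAbove f a zero = refl
sumFrom-countAbove f a (suc n)
  rewrite sumFrom-cong {λ x → if f x then countAbove f a (suc n) x else 0}
                       {λ x → if f x then countAbove f (suc a) n x else 0}
                       (suc a) n (λ x _ _ → cong (if f x then_else 0) (countAbove-suc f a n x))
        | sumFrom-countAbove f (suc a) n | countAbove-start f a (suc n) with f a
... | true = sym (C2-suc (countFrom f (suc a) n))
... | false = refl

sumFrom-countAbove-C2 : ∀ f a n → sumFrom (λ x → if f x then countAbove f a n x C 2 else 0) a n ≡ countFrom f a n C 3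
sumFrom-countAbove-C2 f a zero = refl
sumFrom-countAbove-C2 f a (suc n)
  rewrite sumFrom-cong {λ x → if f x then countAbove f a (suc n) x C 2 else 0}
                       {λ x → if f x then countAbove f (suc a) n x C 2 else 0}
                       (suc a) n (λ x _ _ → cong (λ z → if f x then z C 2 else 0) (countAbove-suc f a n x))
        | sumFrom-countAbove-C2 f (suc a) n | countAbove-start f a (suc n) with f a
... | true = sym (C3-suc (countFrom f (suc a) n))
... | false = refl

sumIf : (ℕ → Bool) → (ℕ → ℕ) → ℕ → ℕ → ℕ
sumIf f g a n = sumFrom (λ y → if f y then g y else 0) a n

sumIfAbove : (ℕ → Bool) → (ℕ → ℕ) → ℕ → ℕ → ℕ → ℕ
sumIfAbove f g a n x = sumIf f g (suc x) (a + n ∸ suc x)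

sumIfAbove-suc : ∀ f g a n x → sumIfAbove f g a (suc n) x ≡ sumIfAbove f g (suc a) n x
sumIfAbove-suc f g a n x = cong (λ z → sumIf f g (suc x) (z ∸ suc x)) (+-suc a n)

sumIfAbove-start : ∀ f g a n → sumIfAbove f g a (suc n) a ≡ sumIf f g (suc a) n
sumIfAbove-start f g a n = cong (sumIf f g (suc a)) (trans (cong (_∸ suc a) (+-suc a n)) (m+n∸m≡n (suc a) n))

private
  pairs-step : ∀ g X G r → (g * X + G) + r + (g + G) ≡ (r + G) + (g * X + g + G)
  pairs-step = solve-∀
  pairs-close : ∀ g X G → X * G + (g * X + g + G) ≡ (1 + X) * (g + G)
  pairs-close = solve-∀

-- The left side adds g x + g y over the pairs x < y of points of f, and g once more over f.
sumFrom-pairs : ∀ f g a n → sumFrom (λ x → if f x then g x * countAbove f a n x + sumIfAbove f g a n x else 0) a n + sumIf f g a n ≡ countFrom f a n * sumIf f g a n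
sumFrom-pairs f g a zero = refl
sumFrom-pairs f g a (suc n)
  rewrite sumFrom-cong {λ x → if f x then g x * countAbove f a (suc n) x + sumIfAbove f g a (suc n) x else 0}
                       {λ x → if f x then g x * countAbove f (suc a) n x + sumIfAbove f g (suc a) n x else 0}
                       (suc a) n (λ x _ _ → cong (λ z → if f x then z else 0)
                                   (cong₂ _+_ (cong (g x *_) (countAbove-suc f a n x)) (sumIfAbove-suc f g a n x)))
        | countAbove-start f a (suc n) | sumIfAbove-start f g a n with f a | sumFrom-pairs f g (suc a) n
... | true | ih =
  trans (pairs-step (g a) (countFrom f (suc a) n) (sumIf f g (suc a) n) _)
        (trans (cong (_+ (g a * countFrom f (suc a) n + g a + sumIf f g (suc a) n)) ih)
               (pairs-close (g a) (countFrom f (suc a) n) (sumIf f g (suc a) n)))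
... | false | ih = ih

if-+-distrib : ∀ b p q → (if b then p + q else 0) ≡ (if b then p else 0) + (if b then q else 0)
if-+-distrib true p q = refl
if-+-distrib false p q = refl

if-δ : ∀ b b' → (if b then δ b' else 0) ≡ δ (b ∧ b')
if-δ true b' = refl
if-δ false b' = refl

sumFrom-if-+ : ∀ (f : ℕ → Bool) (p q : ℕ → ℕ) a n → sumFrom (λ x → if f x then p x + q x else 0) a n ≡ sumFrom (λ x → if f x then p x else 0) a n + sumFrom (λ x → if f x then q x else 0) a n
sumFrom-if-+ f p q a n =
  trans (sumFrom-cong {λ x → if f x then p x + q x else 0} {λ x → (if f x then p x else 0) + (if f x then q x else 0)}
                      a n (λ x _ _ → if-+-distrib (f x) (p x) (q x)))
        (sumFrom-+ (λ x → if f x then p x else 0) (λ x → if f x then q x else 0) a n)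

C2-+δ : ∀ n b → (n + δ b) C 2 ≡ n C 2 + δ b * n
C2-+δ n true = trans (cong (_C 2) (+-comm n 1)) (trans (C2-suc n) (trans (+-comm n (n C 2)) (cong (n C 2 +_) (sym (+-identityʳ n)))))
C2-+δ n false = trans (cong (_C 2) (+-identityʳ n)) (sym (+-identityʳ (n C 2)))

δ-split : ∀ r t n → (T t → T n) → δ (r ∧ n) ≡ (if r then δ t else 0) + δ (r ∧ not t ∧ n)
δ-split false t n h = refl
δ-split true true n h with n | h tt
... | true | _ = refl
δ-split true false n h = refl

+≡*⇒≡*∸1 : ∀ X T N → T ≤ N → X + T ≡ N * T → X ≡ T * (N ∸ 1)
+≡*⇒≡*∸1 X zero N _ e = trans (sym (+-identityʳ X)) (trans e (*-zeroʳ N))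
+≡*⇒≡*∸1 X (suc T) (suc N) _ e = +-cancelʳ-≡ (suc T) X (suc T * N) (trans e (trans (*-comm (suc N) (suc T)) (trans (*-suc (suc T) N) (+-comm (suc T) (suc T * N)))))

module DescendantSums (Λ : NumericalSemigroup) where
  open Basics Λ

  nGrandchildren≡sum : nGrandchildren R ≡ sumFrom (λ x → if rg? x then nChildren (remove R x) else 0) 0 (suc (c + m))
  nGrandchildren≡sum = trans (cong sum (sym (map-∘ (rightGens R)))) (sum-map-filter-upTo (nChildren ∘ remove R) rg? (suc (c + m)))

  nGreatGrandchildren≡sum : nGreatGrandchildren R ≡ sumFrom (λ x → if rg? x then nGrandchildren (remove R x) else 0) 0 (suc (c + m))
  nGreatGrandchildren≡sum = trans (cong sum (sym (map-∘ (rightGens R)))) (sum-map-filter-upTo (nGrandchildren ∘ remove R) rg? (suc (c + m)))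

module Grandchildren (Λ : NumericalSemigroup) (k≥2 : 2 ≤ Basics.k Λ) where
  open Basics Λ
  open DescendantSums Λ

  m<c : m < c
  m<c = elt<conductor 1 k≥2

  c≥1 : 1 ≤ c
  c≥1 = ≤-trans m>0 (<⇒≤ m<c)

  rightGen>m : ∀ x → T (rg? x) → m < x
  rightGen>m x t = <-≤-trans m<c (proj₁ (isRightGen-sound x t))

  nChildren-child : ∀ x → (if rg? x then nChildren (remove R x) else 0) ≡ (if rg? x then gensAbove x + δ (noDecomp M m x) else 0)
  nChildren-child x with rg? x in eq
  ... | false = refl
  ... | true = trans (S'.nChildren≡nGens (subst (1 ≤_) (sym conductor') (s≤s z≤n))) (nGens'≡ (rightGen>m x t) c≥1)
    where
    t : T (rg? x)
    t = subst T (sym eq) tt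
    open Child Λ x t

  nGrandchildren≡ : nGrandchildren R ≡ nGens C 2 + nSeedGens
  nGrandchildren≡ = begin
      nGrandchildren R ≡⟨ nGrandchildren≡sum ⟩
      sumFrom (λ x → if rg? x then nChildren (remove R x) else 0) 0 (suc (c + m)) ≡⟨ sumFrom-restrict-rightGens c≥1 _ (λ x h → if-not-rightGen (nChildren ∘ remove R) x h) ⟩
      sumFrom (λ x → if rg? x then nChildren (remove R x) else 0) c m ≡⟨ sumFrom-cong c m (λ x _ _ → nChildren-child x) ⟩
      sumFrom (λ x → if rg? x then gensAbove x + δ (noDecomp M m x) else 0) c m ≡⟨ sumFrom-if-+ rg? gensAbove (λ x → δ (noDecomp M m x)) c m ⟩
      sumFrom (λ x → if rg? x then gensAbove x else 0) c m + sumFrom (λ x → if rg? x then δ (noDecomp M m x) else 0) c m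
        ≡⟨ cong₂ _+_ (sumFrom-countAbove rg? c m) (sumFrom-cong c m (λ x _ _ → if-δ (rg? x) (noDecomp M m x))) ⟩
      nGens C 2 + nSeedGens ∎
    where open ≡-Reasoning

module GreatGrandchildren (Λ : NumericalSemigroup) (k≥2 : 2 ≤ Basics.k Λ) where
  open Basics Λ
  open DescendantSums Λ
  open Grandchildren Λ k≥2

  seed₁? : ℕ → Bool
  seed₁? x = noDecomp M m x

  revivedSeeds : ℕ → ℕ
  revivedSeeds x = countFrom (λ y → rg? y ∧ not (seed₁? y) ∧ noDecomp (M-without x) m y) (suc x) (c + m ∸ suc x)

  topSeed : ℕ → ℕ
  topSeed x = δ (seed₁? x ∧ noDecomp (M-without x) m (x + m))

  extraSeeds : ℕ
  extraSeeds = sumFrom (λ x → if rg? x then revivedSeeds x + topSeed x else 0) c m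

  seed₁δ : ℕ → ℕ
  seed₁δ x = δ (seed₁? x)

  nGrandchildrenOfChild : ℕ → ℕ
  nGrandchildrenOfChild x = gensAbove x C 2 + (seed₁δ x * gensAbove x + sumIfAbove rg? seed₁δ c m x) + (revivedSeeds x + topSeed x)

  seed₁⇒seed₁-without : ∀ x y → T (seed₁? y) → T (noDecomp (M-without x) m y)
  seed₁⇒seed₁-without x y t = noDecomp-complete (M-without x) m y (λ d → noDecomp-sound M m y t (dec x d))
    where
    dec : ∀ x → Decomposition (M-without x) m y → Decomposition M m y
    dec x (a , b , ma , mb , r) = a , b , proj₁ (and2 (M a) _ ma) , proj₁ (and2 (M b) _ mb) , r

  nGrandchildren-child : ∀ x → (if rg? x then nGrandchildren (remove R x) else 0) ≡ (if rg? x then nGrandchildrenOfChild x else 0)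
  nGrandchildren-child x with rg? x in eq
  ... | false = refl
  ... | true = begin
      nGrandchildren (remove R x) ≡⟨ Grandchildren.nGrandchildren≡ Λ' (≤-trans k≥2 rank≤rank') ⟩
      S'.nGens C 2 + S'.nSeedGens ≡⟨ cong₂ _+_ (cong (_C 2) (nGens'≡ (rightGen>m x t) c≥1)) (nSeedGens'≡ (rightGen>m x t) c≥1) ⟩
      (gensAbove x + seed₁δ x) C 2 + (countFrom (λ y → rg? y ∧ noDecomp S'.M m y) (suc x) (c + m ∸ suc x) + topSeed x)
        ≡⟨ cong₂ _+_ (C2-+δ (gensAbove x) (seed₁? x)) (cong (_+ topSeed x) (trans (sumFrom-cong (suc x) (c + m ∸ suc x)
               (λ y _ _ → δ-split (rg? y) (seed₁? y) (noDecomp S'.M m y) (seed₁⇒seed₁-without x y)))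
               (sumFrom-+ (λ y → if rg? y then seed₁δ y else 0) (λ y → δ (rg? y ∧ not (seed₁? y) ∧ noDecomp (M-without x) m y)) (suc x) (c + m ∸ suc x)))) ⟩
      (gensAbove x C 2 + seed₁δ x * gensAbove x) + (sumIfAbove rg? seed₁δ c m x + revivedSeeds x + topSeed x) ≡⟨ regroup (gensAbove x C 2) (seed₁δ x * gensAbove x) (sumIfAbove rg? seed₁δ c m x) (revivedSeeds x) (topSeed x) ⟩
      nGrandchildrenOfChild x ∎
    where
    t : T (rg? x)
    t = subst T (sym eq) tt
    open Child Λ x t
    open ≡-Reasoning
    regroup : ∀ a b p q r → (a + b) + (p + q + r) ≡ a + (b + p) + (q + r)
    regroup = solve-∀

  nSeedGens≤nGens : nSeedGens ≤ nGens
  nSeedGens≤nGens = sumFrom-mono c m (λ x → le (rg? x) (noDecomp M m x))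
    where
    le : ∀ a b → δ (a ∧ b) ≤ δ a
    le true true = ≤-refl
    le true false = z≤n
    le false b = z≤n

  nGreatGrandchildren≡ : nGreatGrandchildren R ≡ nGens C 3 + nSeedGens * (nGens ∸ 1) + extraSeeds
  nGreatGrandchildren≡ = begin
      nGreatGrandchildren R ≡⟨ nGreatGrandchildren≡sum ⟩
      sumFrom (λ x → if rg? x then nGrandchildren (remove R x) else 0) 0 (suc (c + m)) ≡⟨ sumFrom-restrict-rightGens c≥1 _ (λ x h → if-not-rightGen (nGrandchildren ∘ remove R) x h) ⟩
      sumFrom (λ x → if rg? x then nGrandchildren (remove R x) else 0) c m ≡⟨ sumFrom-cong c m (λ x _ _ → nGrandchildren-child x) ⟩
      sumFrom (λ x → if rg? x then nGrandchildrenOfChild x else 0) c m ≡⟨ sumFrom-if-+ rg? (λ x → gensAbove x C 2 + (seed₁δ x * gensAbove x + sumIfAbove rg? seed₁δ c m x)) (λ x → revivedSeeds x + topSeed x) c m ⟩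
      sumFrom (λ x → if rg? x then gensAbove x C 2 + (seed₁δ x * gensAbove x + sumIfAbove rg? seed₁δ c m x) else 0) c m + extraSeeds
        ≡⟨ cong (_+ extraSeeds) (sumFrom-if-+ rg? (λ x → gensAbove x C 2) (λ x → seed₁δ x * gensAbove x + sumIfAbove rg? seed₁δ c m x) c m) ⟩
      sumFrom (λ x → if rg? x then gensAbove x C 2 else 0) c m + sumFrom (λ x → if rg? x then seed₁δ x * gensAbove x + sumIfAbove rg? seed₁δ c m x else 0) c m + extraSeeds
        ≡⟨ cong (λ z → z + sumFrom (λ x → if rg? x then seed₁δ x * gensAbove x + sumIfAbove rg? seed₁δ c m x else 0) c m + extraSeeds) (sumFrom-countAbove-C2 rg? c m) ⟩
      nGens C 3 + sumFrom (λ x → if rg? x then seed₁δ x * gensAbove x + sumIfAbove rg? seed₁δ c m x else 0) c m + extraSeeds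
        ≡⟨ cong (λ z → nGens C 3 + z + extraSeeds) mid ⟩
      nGens C 3 + nSeedGens * (nGens ∸ 1) + extraSeeds ∎
    where
    open ≡-Reasoning
    gsT : sumIf rg? seed₁δ c m ≡ nSeedGens
    gsT = sumFrom-cong c m (λ x _ _ → if-δ (rg? x) (seed₁? x))
    pairs = sumFrom (λ x → if rg? x then seed₁δ x * gensAbove x + sumIfAbove rg? seed₁δ c m x else 0) c m
    mid : pairs ≡ nSeedGens * (nGens ∸ 1)
    mid = +≡*⇒≡*∸1 pairs nSeedGens nGens nSeedGens≤nGens
            (subst (λ z → pairs + z ≡ nGens * z) gsT (sumFrom-pairs rg? seed₁δ c m))

-- The seed bitstream

countFrom≡w : ∀ a n → 1 ≤ n → countFrom a 0 n ≡ w 0 (n ∸ 1) a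
countFrom≡w a n n≥1 = trans (cong (countFrom a 0) (sym (m+[n∸m]≡n n≥1)))
                            (sym (length-filter-upTo (λ ℓ → (0 ≤ᵇ ℓ) ∧ a ℓ) (suc (n ∸ 1))))

module Seeds (Λ : NumericalSemigroup) where
  open Basics Λ

  S : ℕ → Bool
  S = seedStream R

  isSeed≡noDecomp : ∀ p x → p < k → c ≤ x → isSeed R p x ≡ noDecomp M (elt R p) x
  isSeed≡noDecomp p x pk cx = bool-ext (λ t → noDecomp-complete M (elt R p) x (proj₂ (proj₂ (proj₂ (isSeed-sound p x t)))))
                             (λ t → isSeed-complete p x pk (M-≥c x cx) cx (noDecomp-sound M (elt R p) x t))

  S-at : ∀ i j → i < c → elt R j ≤ i → i < elt R (suc j) → j < k → S i ≡ noDecomp M (elt R j) (c + i ∸ elt R j)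
  S-at i j ic p q jk = trans (seedStream-at i j ic p q) (isSeed≡noDecomp j (c + i ∸ elt R j) jk
     (subst (_≤ c + i ∸ elt R j) (m+n∸n≡m c (elt R j)) (∸-monoʳ-≤' c p)))
    where
    ∸-monoʳ-≤' : ∀ c {a b} → a ≤ b → c + a ∸ a ≤ c + b ∸ a
    ∸-monoʳ-≤' c {a} {b} h = ∸-monoˡ-≤ a (+-monoʳ-≤ c h)

  λ2 : ℕ
  λ2 = elt R 2
  λ3 : ℕ
  λ3 = elt R 3
  u : ℕ
  u = λ2 ∸ m
  v : ℕ
  v = λ3 ∸ λ2

  m<λ2 : m < λ2
  m<λ2 = elt-mono-< (s≤s (s≤s z≤n))

  λ2<λ3 : λ2 < λ3
  λ2<λ3 = elt-mono-< (s≤s (s≤s (s≤s z≤n)))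

  m+u≡λ2 : m + u ≡ λ2
  m+u≡λ2 = m+[n∸m]≡n (<⇒≤ m<λ2)

  λ2+v≡λ3 : λ2 + v ≡ λ3
  λ2+v≡λ3 = m+[n∸m]≡n (<⇒≤ λ2<λ3)

  u≥1 : 1 ≤ u
  u≥1 = subst (1 ≤_) refl (m<n⇒0<n∸m m<λ2)

  λ2≤2m : λ2 ≤ m + m
  λ2≤2m = elt-next 1 (m + m) (M-+ M-m M-m) (subst (_< m + m) (+-identityʳ m) (+-monoʳ-< m m>0))

  u≤m : u ≤ m
  u≤m = +-cancelˡ-≤ m u m (subst (_≤ m + m) (sym m+u≡λ2) λ2≤2m)

  λ3≤λ2+m : λ3 ≤ λ2 + m
  λ3≤λ2+m = elt-next 2 (λ2 + m) (M-+ (elt-mem 2) M-m) (subst (_< λ2 + m) (+-identityʳ λ2) (+-monoʳ-< λ2 m>0))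

  v≤m : v ≤ m
  v≤m = +-cancelˡ-≤ λ2 v m (subst (_≤ λ2 + m) (sym λ2+v≡λ3) λ3≤λ2+m)

  v≥1 : 1 ≤ v
  v≥1 = m<n⇒0<n∸m λ2<λ3

  sumFrom-c : ∀ (g : ℕ → ℕ) n → sumFrom g c n ≡ sumFrom (λ i → g (c + i)) 0 n
  sumFrom-c g n = trans (cong (λ z → sumFrom g z n) (sym (+-identityʳ c))) (sumFrom-shift+ g c 0 n)

  module RankAtLeast2 (k≥2 : 2 ≤ k) where

    λ2≤c : λ2 ≤ c
    λ2≤c = subst (λ2 ≤_) elt-rank (elt-mono-≤ k≥2)

    m<c : m < c
    m<c = <-≤-trans m<λ2 λ2≤c

    c≥1 : 1 ≤ c
    c≥1 = ≤-trans m>0 (<⇒≤ m<c)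

    decomposition-via-λ2 : ∀ x → c + u ≤ x → Decomposition M m x
    decomposition-via-λ2 x le = λ2 , x ∸ u , elt-mem 2 , M-≥c (x ∸ u) cx , m<λ2 , ≤-trans λ2≤c cx , ∸-monoʳ-< u≥1 (≤-trans (m≤n+m u c) le) , eq
      where
      cx : c ≤ x ∸ u
      cx = subst (_≤ x ∸ u) (m+n∸n≡m c u) (∸-monoˡ-≤ u le)
      eq : λ2 + (x ∸ u) ≡ x + m
      eq = trans (cong (_+ (x ∸ u)) (sym m+u≡λ2)) (trans (+-assoc m u (x ∸ u)) (trans (cong (m +_) (m+[n∸m]≡n (≤-trans (m≤n+m u c) le))) (+-comm m x)))

    S-below-m : ∀ i → i < m → S i ≡ rg? (c + i)
    S-below-m i im = trans (S-at i 0 (<-trans im m<c) (subst (_≤ i) (sym elt-0) z≤n) im (≤-trans (s≤s z≤n) k≥2))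
      (trans (cong₂ (λ a b → noDecomp M a b) elt-0 (trans (cong (c + i ∸_) elt-0) refl))
      (bool-ext (λ t → isRightGen-complete (c + i) (m≤m+n c i , (λ e → <-irrefl (sym e) (≤-trans c≥1 (m≤m+n c i))) ,
                     M-≥c (c + i) (m≤m+n c i) , noDecomp-sound M 0 (c + i) t))
                (λ t → noDecomp-complete M 0 (c + i) (proj₂ (proj₂ (proj₂ (isRightGen-sound (c + i) t)))))))

    S-from-m : ∀ i → i < u → S (i + m) ≡ noDecomp M m (c + i)
    S-from-m i iu = trans (S-at (i + m) 1 (<-≤-trans (subst (i + m <_) (trans (+-comm u m) m+u≡λ2) (+-monoˡ-< m iu)) λ2≤c)
                   (m≤n+m m i) (subst (i + m <_) (trans (+-comm u m) m+u≡λ2) (+-monoˡ-< m iu)) k≥2)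
                   (cong (noDecomp M m) (trans (cong (_∸ m) (sym (+-assoc c i m))) (m+n∸n≡m (c + i) m)))

    nSeedGens-below-u : nSeedGens ≡ countFrom seedGen? c u
    nSeedGens-below-u = begin
        nSeedGens ≡⟨ cong (countFrom seedGen? c) (sym (m+[n∸m]≡n u≤m)) ⟩
        countFrom seedGen? c (u + (m ∸ u)) ≡⟨ sumFrom-split _ c u (m ∸ u) ⟩
        countFrom seedGen? c u + countFrom seedGen? (c + u) (m ∸ u) ≡⟨ cong (countFrom seedGen? c u +_) (countFrom-none seedGen? (c + u) (m ∸ u)
                   (λ x p _ t → noDecomp-sound M m x (proj₂ (and2 (rg? x) _ t)) (decomposition-via-λ2 x p))) ⟩
        countFrom seedGen? c u + 0 ≡⟨ +-identityʳ _ ⟩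
        countFrom seedGen? c u ∎
      where open ≡-Reasoning

    nSeedGens≡w : nSeedGens ≡ w 0 (u ∸ 1) (S ⋀ (S ≪ m))
    nSeedGens≡w = begin
        nSeedGens ≡⟨ nSeedGens-below-u ⟩
        countFrom seedGen? c u ≡⟨ sumFrom-c _ u ⟩
        countFrom (λ i → seedGen? (c + i)) 0 u ≡⟨ countFrom-cong 0 u (λ i _ iu → sym (cong₂ _∧_ (S-below-m i (<-≤-trans iu u≤m)) (S-from-m i iu))) ⟩
        countFrom (S ⋀ (S ≪ m)) 0 u ≡⟨ countFrom≡w (S ⋀ (S ≪ m)) u u≥1 ⟩
        w 0 (u ∸ 1) (S ⋀ (S ≪ m)) ∎
      where open ≡-Reasoning

    nGens≡w : nGens ≡ w 0 (m ∸ 1) S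
    nGens≡w = begin
        nGens ≡⟨ sumFrom-c _ m ⟩
        countFrom (λ i → rg? (c + i)) 0 m ≡⟨ countFrom-cong 0 m (λ i _ im → sym (S-below-m i im)) ⟩
        countFrom S 0 m ≡⟨ countFrom≡w S m m>0 ⟩
        w 0 (m ∸ 1) S ∎
      where open ≡-Reasoning

    nChildren≡w : nChildren R ≡ w 0 (m ∸ 1) S
    nChildren≡w = trans (nChildren≡nGens c≥1) nGens≡w

    nGrandchildren≡w : nGrandchildren R ≡ nChildren R C 2 + w 0 (u ∸ 1) (S ⋀ (S ≪ m))
    nGrandchildren≡w = trans (Grandchildren.nGrandchildren≡ Λ k≥2)
      (cong₂ (λ a b → a C 2 + b) (sym (nChildren≡nGens c≥1)) nSeedGens≡w)

-- Rank at least 3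

module RankAtLeast3 (Λ : NumericalSemigroup) (k≥3 : 3 ≤ Basics.k Λ) where
  open Basics Λ
  open Seeds Λ
  k≥2 : 2 ≤ k
  k≥2 = ≤-trans (n≤1+n 2) k≥3
  open RankAtLeast2 k≥2
  open Grandchildren Λ k≥2 using (nGrandchildren≡)
  open GreatGrandchildren Λ k≥2

  λ3≤c : λ3 ≤ c
  λ3≤c = subst (λ3 ≤_) elt-rank (elt-mono-≤ k≥3)

  λ2<c : λ2 < c
  λ2<c = <-≤-trans λ2<λ3 λ3≤c

  seed₂? : ℕ → Bool
  seed₂? x = noDecomp M λ2 x

  decomposition-without-above : ∀ x y → c ≤ x → x + u < y → Decomposition (M-without x) m y
  decomposition-without-above x y cx lt = λ2 , y ∸ u , T∧ (elt-mem 2) (Tnot (λ t → <-irrefl (T≡ᵇ t) (<-≤-trans λ2<c cx))) ,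
      T∧ (M-≥c (y ∸ u) (≤-trans cx (<⇒≤ x<)) ) (Tnot (λ t → <-irrefl (sym (T≡ᵇ t)) x<)) ,
      m<λ2 , ≤-trans (<⇒≤ λ2<c) (≤-trans cx (<⇒≤ x<)) , ∸-monoʳ-< u≥1 u≤y , eq
    where
    u≤y : u ≤ y
    u≤y = ≤-trans (m≤n+m u x) (<⇒≤ lt)
    x< : x < y ∸ u
    x< = subst (_< y ∸ u) (m+n∸n≡m x u) (∸-monoˡ-< lt (m≤n+m u x))
    eq : λ2 + (y ∸ u) ≡ y + m
    eq = trans (cong (_+ (y ∸ u)) (sym m+u≡λ2)) (trans (+-assoc m u (y ∸ u)) (trans (cong (m +_) (m+[n∸m]≡n u≤y)) (+-comm m y)))

  x+u+m≡x+λ2 : ∀ x → x + u + m ≡ x + λ2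
  x+u+m≡x+λ2 x = trans (+-assoc x u m) (cong (x +_) (trans (+-comm u m) m+u≡λ2))

  no-element-between-m-λ2 : ∀ b → T (M b) → m < b → b < λ2 → ⊥
  no-element-between-m-λ2 b mb p q = <-irrefl refl (<-≤-trans q (elt-next 1 b mb p))

  decomposition-without-below : ∀ x y → c ≤ x → y < x + u → Decomposition M m y → Decomposition (M-without x) m y
  decomposition-without-below x y cx lt (a , b , ma , mb , pa , ab , by , e) with a ≟ x | b ≟ x
  ... | no a≢ | no b≢ = a , b , T∧ ma (Tnot (λ t → a≢ (T≡ᵇ t))) , T∧ mb (Tnot (λ t → b≢ (T≡ᵇ t))) , pa , ab , by , e
  ... | yes refl | _ = ⊥-elim (no-element-between-m-λ2 b mb (<-≤-trans pa ab) b<λ2)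
    where
    b<λ2 : b < λ2
    b<λ2 = +-cancelˡ-< a b λ2 (subst (_< a + λ2) (sym e) (subst (y + m <_) (x+u+m≡x+λ2 a) (+-monoˡ-< m lt)))
  ... | no _ | yes refl = ⊥-elim (no-element-between-m-λ2 a ma pa a<λ2)
    where
    a<λ2 : a < λ2
    a<λ2 = +-cancelʳ-< b a λ2 (subst (_< λ2 + b) (sym e) (subst (y + m <_) (trans (x+u+m≡x+λ2 b) (+-comm b λ2)) (+-monoˡ-< m lt)))

  seed₁-without-x+u≡seed₂ : ∀ x → c ≤ x → noDecomp (M-without x) m (x + u) ≡ seed₂? x
  seed₁-without-x+u≡seed₂ x cx = bool-ext
    (λ t → noDecomp-complete M λ2 x (λ (a , b , ma , mb , pa , ab , bx , e) →
      noDecomp-sound (M-without x) m (x + u) t (a , b , T∧ ma (Tnot (λ q → <-irrefl (T≡ᵇ q) (≤-<-trans ab bx))) ,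
        T∧ mb (Tnot (λ q → <-irrefl (T≡ᵇ q) bx)) , <-trans m<λ2 pa , ab , <-≤-trans bx (m≤m+n x u) ,
        trans e (trans (cong (x +_) (trans (sym m+u≡λ2) (+-comm m u))) (sym (+-assoc x u m))))))
    (λ t → noDecomp-complete (M-without x) m (x + u) (λ (a , b , ma , mb , pa , ab , bx , e) → go a b ma mb pa ab bx e t))
    where
    go : ∀ a b → T (M-without x a) → T (M-without x b) → m < a → a ≤ b → b < x + u → a + b ≡ x + u + m → T (seed₂? x) → ⊥
    go a b ma mb pa ab bx e t with m≤n⇒m<n∨m≡n (elt-next 1 a (proj₁ (and2 (M a) _ ma)) pa)
    ... | inj₂ refl = Tnot⁻ (proj₂ (and2 (M b) _ mb)) (≡ᵇT (+-cancelˡ-≡ λ2 b x (trans e (trans (+-assoc x u m) (trans (cong (x +_) (trans (+-comm u m) m+u≡λ2)) (+-comm x λ2))))))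
    ... | inj₁ λ2<a = noDecomp-sound M λ2 x t (a , b , proj₁ (and2 (M a) _ ma) , proj₁ (and2 (M b) _ mb) , λ2<a , ab ,
           +-cancelʳ-< a b x (subst (_< x + a) (sym (trans (+-comm b a) (trans e (trans (+-assoc x u m) (cong (x +_) (trans (+-comm u m) m+u≡λ2)))))) (+-monoʳ-< x λ2<a)) ,
           trans e (trans (+-assoc x u m) (cong (x +_) (trans (+-comm u m) m+u≡λ2))))

  decomposition-x+u : ∀ x → c ≤ x → Decomposition M m (x + u)
  decomposition-x+u x cx = λ2 , x , elt-mem 2 , M-≥c x cx , m<λ2 , ≤-trans (<⇒≤ λ2<c) cx , m<m+n x u≥1 ,
    trans (+-comm λ2 x) (sym (x+u+m≡x+λ2 x))

  decomposition-via-λ3 : ∀ x → c + v ≤ x → Decomposition M λ2 x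
  decomposition-via-λ3 x le = λ3 , x ∸ v , elt-mem 3 , M-≥c (x ∸ v) cx , λ2<λ3 , ≤-trans λ3≤c cx , ∸-monoʳ-< v≥1 v≤x , eq
    where
    v≤x : v ≤ x
    v≤x = ≤-trans (m≤n+m v c) le
    cx : c ≤ x ∸ v
    cx = subst (_≤ x ∸ v) (m+n∸n≡m c v) (∸-monoˡ-≤ v le)
    eq : λ3 + (x ∸ v) ≡ x + λ2
    eq = trans (cong (_+ (x ∸ v)) (sym λ2+v≡λ3)) (trans (+-assoc λ2 v (x ∸ v)) (trans (cong (λ2 +_) (m+[n∸m]≡n v≤x)) (+-comm λ2 x)))

  revived? : ℕ → ℕ → Bool
  revived? x y = rg? y ∧ not (seed₁? y) ∧ noDecomp (M-without x) m y

  revived-only-x+u : ∀ x y → c ≤ x → suc x ≤ y → y ≢ x + u → ¬ T (revived? x y)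
  revived-only-x+u x y cx le ne t with and3 (rg? y) (not (seed₁? y)) (noDecomp (M-without x) m y) t
  ... | t1 , t2 , t3 with <-cmp y (x + u)
  ...   | tri≈ _ e _ = ne e
  ...   | tri> _ _ gt = noDecomp-sound (M-without x) m y t3 (decomposition-without-above x y cx gt)
  ...   | tri< lt _ _ = noDecomp-sound (M-without x) m y t3 (decomposition-without-below x y cx lt (noDecomp-witness M m y (Tnot⁻ t2)))

  revived-x+u : ∀ x → c ≤ x → revived? x (x + u) ≡ rg? (x + u) ∧ seed₂? x
  revived-x+u x cx = cong₂ _∧_ refl (cong₂ _∧_ (cong not (noDecomp-false M m (x + u) (decomposition-x+u x cx))) (seed₁-without-x+u≡seed₂ x cx))

  revivedSeeds≡ : ∀ x → T (rg? x) → revivedSeeds x ≡ δ (rg? (x + u) ∧ seed₂? x)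
  revivedSeeds≡ x t with x + u <? c + m
  ... | yes lt = trans (sumFrom-single (suc x) (c + m ∸ suc x) (x + u) (subst (_≤ x + u) (+-comm x 1) (+-monoʳ-≤ x u≥1))
                         (subst (x + u <_) (sym (m+[n∸m]≡n xcm)) lt)
                         (λ y p _ ne → δF (revived-only-x+u x y cx p ne)))
                       (cong δ (revived-x+u x cx))
    where
    cx = proj₁ (isRightGen-sound x t)
    xcm : suc x ≤ c + m
    xcm = rightGen<c+m c≥1 x (isRightGen-sound x t)
  ... | no ge = trans (countFrom-none (revived? x) (suc x) (c + m ∸ suc x)
                   (λ y p q → revived-only-x+u x y cx p (λ e → ge (subst (_< c + m) e (subst (y <_) (m+[n∸m]≡n xcm) q)))))
                 (sym (cong δ (trans (cong (_∧ seed₂? x) (Tfalse (λ t' → ge (rightGen<c+m c≥1 (x + u) (isRightGen-sound (x + u) t'))))) refl)))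
    where
    cx = proj₁ (isRightGen-sound x t)
    xcm : suc x ≤ c + m
    xcm = rightGen<c+m c≥1 x (isRightGen-sound x t)

  topSeed≡ : ∀ x → T (rg? x) → topSeed x ≡ δ (seed₁? x ∧ (u ≡ᵇ m) ∧ seed₂? x)
  topSeed≡ x t with m≤n⇒m<n∨m≡n u≤m
  ... | inj₂ e = cong δ (cong (seed₁? x ∧_) (trans (cong (λ z → noDecomp (M-without x) m (x + z)) (sym e)) (trans (seed₁-without-x+u≡seed₂ x cx) (cong (_∧ seed₂? x) (sym (≡true (≡ᵇT e)))))))
    where
    cx = proj₁ (isRightGen-sound x t)
  ... | inj₁ lt = cong δ (cong (seed₁? x ∧_) (trans (noDecomp-false (M-without x) m (x + m) (decomposition-without-above x (x + m) cx (+-monoʳ-< x lt)))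
                      (sym (cong (_∧ seed₂? x) (Tfalse (λ q → <-irrefl (T≡ᵇ q) lt))))))
    where
    cx = proj₁ (isRightGen-sound x t)

  extraSeedsAt : ℕ → ℕ
  extraSeedsAt x = if rg? x then δ (rg? (x + u) ∧ seed₂? x) + δ (seed₁? x ∧ (u ≡ᵇ m) ∧ seed₂? x) else 0

  extraSeedsAt≡ : ∀ x → (if rg? x then revivedSeeds x + topSeed x else 0) ≡ extraSeedsAt x
  extraSeedsAt≡ x with rg? x in eq
  ... | false = refl
  ... | true = cong₂ _+_ (revivedSeeds≡ x t) (topSeed≡ x t)
    where
    t : T (rg? x)
    t = subst T (sym eq) tt

  extraSeedsAt-≥c+v : ∀ x → c + v ≤ x → extraSeedsAt x ≡ 0
  extraSeedsAt-≥c+v x le with noDecomp-false M λ2 x (decomposition-via-λ3 x le)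
  ... | e = go (rg? x) (rg? (x + u)) (seed₁? x) (u ≡ᵇ m) (seed₂? x) e
    where
    go : ∀ r r' t b n → n ≡ false → (if r then δ (r' ∧ n) + δ (t ∧ b ∧ n) else 0) ≡ 0
    go false r' t b n e = refl
    go true false t b n e = go2 t b n e
      where
      go2 : ∀ t b n → n ≡ false → δ (t ∧ b ∧ n) ≡ 0
      go2 false b n e = refl
      go2 true false n e = refl
      go2 true true n refl = refl
    go true true t b n refl = go3 t b
      where
      go3 : ∀ t b → δ (t ∧ b ∧ false) ≡ 0
      go3 false b = refl
      go3 true false = refl
      go3 true true = refl

  u+v≤m : u < m → u + v ≤ m
  u+v≤m lt = +-cancelˡ-≤ m (u + v) m (subst (_≤ m + m) (trans (trans (sym λ2+v≡λ3) (cong (_+ v) (sym m+u≡λ2))) (+-assoc m u v))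
              (elt-next 2 (m + m) (M-+ M-m M-m) (subst (_< m + m) m+u≡λ2 (+-monoʳ-< m lt))))

  W : ℕ → Bool
  W = (S ⋀ (S ≪ u)) ⋀ (S ≪ (u + m))

  S-from-u+m : ∀ i → i < v → S (i + (u + m)) ≡ seed₂? (c + i)
  S-from-u+m i iv = trans (S-at (i + (u + m)) 2 (<-≤-trans lt3 λ3≤c) (subst (_≤ i + (u + m)) um (m≤n+m (u + m) i)) lt3 k≥3)
                  (cong (noDecomp M λ2) (trans (cong (λ z → c + (i + z) ∸ λ2) um) (trans (cong (_∸ λ2) (sym (+-assoc c i λ2))) (m+n∸n≡m (c + i) λ2))))
    where
    um : u + m ≡ λ2
    um = trans (+-comm u m) m+u≡λ2
    lt3 : i + (u + m) < λ3
    lt3 = subst (i + (u + m) <_) (trans (cong (v +_) um) (trans (+-comm v λ2) λ2+v≡λ3)) (+-monoˡ-< (u + m) iv)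

  δ-if-u<m : ∀ r r' t n → (if r then δ (r' ∧ n) + δ (t ∧ false ∧ n) else 0) ≡ δ ((r ∧ r') ∧ n)
  δ-if-u<m false r' t n = refl
  δ-if-u<m true r' false n = +-identityʳ _
  δ-if-u<m true r' true n = +-identityʳ _

  δ-if-u≡m : ∀ r t n → (if r then δ (false ∧ n) + δ (t ∧ true ∧ n) else 0) ≡ δ ((r ∧ t) ∧ n)
  δ-if-u≡m false t n = refl
  δ-if-u≡m true false n = refl
  δ-if-u≡m true true n = refl

  extraSeedsAt≡W : ∀ i → i < v → extraSeedsAt (c + i) ≡ δ (W i)
  extraSeedsAt≡W i iv with m≤n⇒m<n∨m≡n u≤m
  ... | inj₁ lt = begin
      extraSeedsAt (c + i) ≡⟨ cong (λ b → if rg? (c + i) then δ (rg? (c + i + u) ∧ seed₂? (c + i)) + δ (seed₁? (c + i) ∧ b ∧ seed₂? (c + i)) else 0)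
                       (Tfalse (λ q → <-irrefl (T≡ᵇ q) lt)) ⟩
      _ ≡⟨ δ-if-u<m (rg? (c + i)) (rg? (c + i + u)) (seed₁? (c + i)) (seed₂? (c + i)) ⟩
      δ ((rg? (c + i) ∧ rg? (c + i + u)) ∧ seed₂? (c + i)) ≡⟨ cong δ (cong₂ _∧_ (cong₂ _∧_ (sym (S-below-m i im)) (trans (cong rg? (+-assoc c i u)) (sym (S-below-m (i + u) iu)))) (sym (S-from-u+m i iv))) ⟩
      δ (W i) ∎
    where
    open ≡-Reasoning
    im : i < m
    im = <-≤-trans iv v≤m
    iu : i + u < m
    iu = <-≤-trans (subst (i + u <_) (+-comm v u) (+-monoˡ-< u iv)) (u+v≤m lt)
  ... | inj₂ e = begin
      extraSeedsAt (c + i) ≡⟨ cong₂ (λ b b' → if rg? (c + i) then δ (b ∧ seed₂? (c + i)) + δ (seed₁? (c + i) ∧ b' ∧ seed₂? (c + i)) else 0)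
                       (Tfalse (λ q → <-irrefl refl (<-≤-trans (rightGen<c+m c≥1 (c + i + u) (isRightGen-sound _ q)) (subst (λ z → c + z ≤ c + i + u) e (subst (c + u ≤_) (sym (+-assoc c i u)) (+-monoʳ-≤ c (m≤n+m u i)))))))
                       (≡true (≡ᵇT e)) ⟩
      _ ≡⟨ δ-if-u≡m (rg? (c + i)) (seed₁? (c + i)) (seed₂? (c + i)) ⟩
      δ ((rg? (c + i) ∧ seed₁? (c + i)) ∧ seed₂? (c + i)) ≡⟨ cong δ (cong₂ _∧_ (cong₂ _∧_ (sym (S-below-m i im)) (sym (trans (cong (λ z → S (i + z)) e) (S-from-m i (subst (i <_) (sym e) im))))) (sym (S-from-u+m i iv))) ⟩
      δ (W i) ∎
    where
    open ≡-Reasoning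
    im : i < m
    im = <-≤-trans iv v≤m

  extraSeeds≡w : extraSeeds ≡ w 0 (v ∸ 1) W
  extraSeeds≡w = begin
      extraSeeds ≡⟨ sumFrom-cong c m (λ x _ _ → extraSeedsAt≡ x) ⟩
      sumFrom extraSeedsAt c m ≡⟨ cong (sumFrom extraSeedsAt c) (sym (m+[n∸m]≡n v≤m)) ⟩
      sumFrom extraSeedsAt c (v + (m ∸ v)) ≡⟨ sumFrom-split extraSeedsAt c v (m ∸ v) ⟩
      sumFrom extraSeedsAt c v + sumFrom extraSeedsAt (c + v) (m ∸ v) ≡⟨ cong (sumFrom extraSeedsAt c v +_) (sumFrom-zero (c + v) (m ∸ v) (λ x p _ → extraSeedsAt-≥c+v x p)) ⟩
      sumFrom extraSeedsAt c v + 0 ≡⟨ +-identityʳ _ ⟩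
      sumFrom extraSeedsAt c v ≡⟨ sumFrom-c extraSeedsAt v ⟩
      sumFrom (λ i → extraSeedsAt (c + i)) 0 v ≡⟨ sumFrom-cong 0 v (λ i _ iv → extraSeedsAt≡W i iv) ⟩
      countFrom W 0 v ≡⟨ countFrom≡w W v v≥1 ⟩
      w 0 (v ∸ 1) W ∎
    where open ≡-Reasoning

  nGreatGrandchildren≡w : nGreatGrandchildren R ≡ nChildren R C 3 + w 0 (u ∸ 1) (S ⋀ (S ≪ m)) * (nChildren R ∸ 1) + w 0 (v ∸ 1) W
  nGreatGrandchildren≡w = trans nGreatGrandchildren≡
    (cong₂ _+_ (cong₂ (λ a b → a C 3 + b * (a ∸ 1)) (sym (nChildren≡nGens c≥1)) nSeedGens≡w) extraSeeds≡w)

-- Rank 2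

2*n≡n+n : ∀ u → 2 * u ≡ u + u
2*n≡n+n = solve-∀
2*n+1≡n+[1+n] : ∀ u → 2 * u + 1 ≡ u + suc u
2*n+1≡n+[1+n] = solve-∀
a+b+0+[b+0]≡a+2*b+0 : ∀ a b → a + b + 0 + (b + 0) ≡ a + 2 * b + 0
a+b+0+[b+0]≡a+2*b+0 = solve-∀
c+[c+2]≡[1+c]+[1+c] : ∀ c → c + (c + 2) ≡ suc c + suc c
c+[c+2]≡[1+c]+[1+c] = solve-∀
c+c+2≡[1+c]+[1+c] : ∀ c → c + c + 2 ≡ suc c + suc c
c+c+2≡[1+c]+[1+c] = solve-∀
1+c+m+m≡c+[1+m+m] : ∀ c m → suc c + m + m ≡ c + suc (m + m)
1+c+m+m≡c+[1+m+m] = solve-∀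
c+[2+u]+m≡c+u+m+2 : ∀ c u m → c + suc (suc u) + m ≡ c + u + m + 2
c+[2+u]+m≡c+u+m+2 = solve-∀

countFrom-not : ∀ f a n → countFrom (λ x → not (f x)) a n ≡ n ∸ countFrom f a n
countFrom-not f a n = sym (trans (cong (_∸ countFrom f a n) (sym (countFrom-+-not f a n))) (m+n∸m≡n (countFrom f a n) _))

1+u<m⇒u<m∸1 : ∀ {u m} → suc u < m → u < m ∸ 1
1+u<m⇒u<m∸1 h = ∸-monoˡ-< h (s≤s z≤n)

extraSeeds-rank2-closed : ∀ m u → 1 ≤ u → u ≤ m → 2 ≤ m →
  (if not (u ≡ᵇ m) then δ ((u <ᵇ m) ∧ not (u + u ≡ᵇ m)) + δ ((suc u <ᵇ m) ∧ not (u + suc u ≡ᵇ m)) + δ (m ≤ᵇ suc u) else 0)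
  + (if not (suc u ≡ᵇ m) then δ ((suc u <ᵇ m) ∧ not (u + suc u ≡ᵇ m)) + δ (u ≡ᵇ m) else 0)
  ≡ δ ((u ≡ᵇ m) ∨ not (2 * u ≡ᵇ m)) + 2 * δ ((u <ᵇ m ∸ 1) ∧ not (2 * u + 1 ≡ᵇ m)) + δ (u ≡ᵇ m ∸ 1)
extraSeeds-rank2-closed m u u≥1 u≤m m≥2 rewrite 2*n+1≡n+[1+n] u | 2*n≡n+n u with m≤n⇒m<n∨m≡n u≤m
... | inj₂ refl rewrite ≡ᵇ-refl u | ≢⇒≡ᵇ≡false {suc u} {u} (λ e → <-irrefl (sym e) (n<1+n u))
                       | Tfalse (λ t → <-irrefl refl (<-trans (n<1+n u) (T<ᵇ {suc u} {u} t)))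
                       | ≢⇒≡ᵇ≡false {u} {u ∸ 1} (λ e → <-irrefl (sym e) (∸-monoʳ-< (s≤s z≤n) u≥1))
                       | Tfalse (λ t → <-irrefl refl (<-trans (T<ᵇ {u} {u ∸ 1} t) (∸-monoʳ-< (s≤s z≤n) u≥1))) = refl
... | inj₁ lt with m≤n⇒m<n∨m≡n lt
...   | inj₂ refl rewrite ≢⇒≡ᵇ≡false {u} {suc u} (<⇒≢ (n<1+n u)) | ≡true (<ᵇT (n<1+n u)) | ≡ᵇ-refl (suc u) | Tfalse (λ t → <-irrefl refl (T<ᵇ {suc u} {suc u} t)) =
          +-identityʳ _
...   | inj₁ lt2 rewrite ≢⇒≡ᵇ≡false {u} {m} (<⇒≢ lt) | ≢⇒≡ᵇ≡false {suc u} {m} (<⇒≢ lt2) | ≡true (<ᵇT lt) | ≡true (<ᵇT lt2)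
                         | Tfalse (λ t → <-irrefl refl (<-≤-trans lt2 (T≤ᵇ {m} {suc u} t)))
                         | ≡true (<ᵇT (1+u<m⇒u<m∸1 lt2)) | ≢⇒≡ᵇ≡false {u} {m ∸ 1} (<⇒≢ (1+u<m⇒u<m∸1 lt2)) = a+b+0+[b+0]≡a+2*b+0 (δ (not (u + u ≡ᵇ m))) (δ (not (u + suc u ≡ᵇ m)))

module Rank2 (Λ : NumericalSemigroup) (k≡2 : Basics.k Λ ≡ 2) where
  open Basics Λ
  open Seeds Λ
  k≥2 : 2 ≤ k
  k≥2 = ≤-reflexive (sym k≡2)
  open RankAtLeast2 k≥2
  open GreatGrandchildren Λ k≥2

  λ2≡c : λ2 ≡ c
  λ2≡c = trans (cong (elt R) (sym k≡2)) elt-rank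

  c≡m+u : c ≡ m + u
  c≡m+u = trans (sym λ2≡c) (sym m+u≡λ2)

  member>m⇒c≤ : ∀ x → T (M x) → m < x → c ≤ x
  member>m⇒c≤ x mx p = subst (_≤ x) λ2≡c (elt-next 1 x mx p)

  c≤2m : c ≤ m + m
  c≤2m = subst (_≤ m + m) λ2≡c λ2≤2m

  m≥2 : 2 ≤ m
  m≥2 with m | m>0 | m<c | c≤2m | M-m
  ... | suc zero | _ | mc | c2 | mm = ⊥-elim (conductor-gap 1 (≤-antisym c2 mc) mm)
  ... | suc (suc m'≡m) | _ | _ | _ | _ = s≤s (s≤s z≤n)

  2m<cm : m + m < c + m
  2m<cm = +-monoˡ-< m m<c

  rg?≡not-2m : ∀ x → c ≤ x → x < c + m → rg? x ≡ not (x ≡ᵇ m + m)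
  rg?≡not-2m x cx xcm = bool-ext
    (λ t → Tnot (λ q → proj₂ (proj₂ (proj₂ (isRightGen-sound x t))) (m , m , M-m , M-m , m>0 , ≤-refl ,
              subst (m <_) (sym (T≡ᵇ q)) (subst (_< m + m) (+-identityʳ m) (+-monoʳ-< m m>0)) , trans (sym (T≡ᵇ q)) (sym (+-identityʳ x)))))
    (λ t → isRightGen-complete x (cx , (λ e → <-irrefl (sym e) (≤-trans c≥1 cx)) , M-≥c x cx , nd (Tnot⁻ t)))
    where
    nd : ¬ T (x ≡ᵇ m + m) → ¬ Decomposition M 0 x
    nd ne (a , b , ma , mb , pa , ab , bx , e) with m≤n⇒m<n∨m≡n (m-minimal a ma (λ q → <-irrefl (sym q) pa))
    ... | inj₁ m<a = <-irrefl refl (<-≤-trans (<-≤-trans xcm (+-monoʳ-≤ c (<⇒≤ m<c))) (subst (c + c ≤_) (trans e (+-identityʳ x)) (+-mono-≤ (member>m⇒c≤ a ma m<a) (member>m⇒c≤ b mb (<-≤-trans m<a ab)))))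
    ... | inj₂ refl with m≤n⇒m<n∨m≡n ab
    ...   | inj₁ m<b = <-irrefl refl (<-≤-trans xcm (subst (c + m ≤_) (trans (+-comm b m) (trans e (+-identityʳ x))) (+-monoˡ-≤ m (member>m⇒c≤ b mb m<b))))
    ...   | inj₂ refl = ne (≡ᵇT (sym (trans e (+-identityʳ x))))

  nGens≡m∸1 : nGens ≡ m ∸ 1
  nGens≡m∸1 = begin
      nGens ≡⟨ countFrom-cong c m (λ x p q → rg?≡not-2m x p q) ⟩
      countFrom (λ x → not (x ≡ᵇ m + m)) c m ≡⟨ countFrom-not (λ x → x ≡ᵇ m + m) c m ⟩
      m ∸ countFrom (λ x → x ≡ᵇ m + m) c m ≡⟨ cong (m ∸_) (countFrom-≡ᵇ (m + m) c m) ⟩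
      m ∸ δ ((c ≤ᵇ m + m) ∧ (m + m <ᵇ c + m)) ≡⟨ cong (λ z → m ∸ δ z) (cong₂ _∧_ (≡true (≤ᵇT c≤2m)) (≡true (<ᵇT 2m<cm))) ⟩
      m ∸ 1 ∎
    where open ≡-Reasoning

  members>m⇒2c≤ : ∀ a b → T (M a) → T (M b) → m < a → a ≤ b → c + c ≤ a + b
  members>m⇒2c≤ a b ma mb p ab = +-mono-≤ (member>m⇒c≤ a ma p) (member>m⇒c≤ b mb (<-≤-trans p ab))

  c+c≡c+u+m : c + c ≡ c + u + m
  c+c≡c+u+m = trans (cong (c +_) (trans c≡m+u (+-comm m u))) (sym (+-assoc c u m))

  seed₁?≡<c+u : ∀ y → c ≤ y → seed₁? y ≡ (y <ᵇ c + u)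
  seed₁?≡<c+u y cy with y <? c + u
  ... | yes lt = trans (≡true (noDecomp-complete M m y (λ (a , b , ma , mb , pa , ab , by , e) →
                   <-irrefl refl (<-≤-trans (+-monoˡ-< m lt) (subst (_≤ y + m) c+c≡c+u+m (subst (c + c ≤_) e (members>m⇒2c≤ a b ma mb pa ab)))))))
                 (sym (≡true (<ᵇT lt)))
  ... | no ge = trans (noDecomp-false M m y (decomposition-via-λ2 y (≮⇒≥ ge))) (sym (Tfalse (λ t → ge (T<ᵇ t))))

  nSeedGens≡ : nSeedGens ≡ u ∸ δ (m <ᵇ 2 * u)
  nSeedGens≡ = begin
      nSeedGens ≡⟨ nSeedGens-below-u ⟩
      countFrom seedGen? c u ≡⟨ countFrom-cong c u (λ x p q → trans (cong₂ _∧_ (rg?≡not-2m x p (<-≤-trans q (+-monoʳ-≤ c u≤m))) (seed₁?≡<c+u x p)) (cong (not (x ≡ᵇ m + m) ∧_) (≡true (<ᵇT q)))) ⟩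
      countFrom (λ x → not (x ≡ᵇ m + m) ∧ true) c u ≡⟨ countFrom-cong c u (λ x _ _ → ∧-identityʳ (not (x ≡ᵇ m + m))) ⟩
      countFrom (λ x → not (x ≡ᵇ m + m)) c u ≡⟨ countFrom-not (λ x → x ≡ᵇ m + m) c u ⟩
      u ∸ countFrom (λ x → x ≡ᵇ m + m) c u ≡⟨ cong (u ∸_) (countFrom-≡ᵇ (m + m) c u) ⟩
      u ∸ δ ((c ≤ᵇ m + m) ∧ (m + m <ᵇ c + u)) ≡⟨ cong (λ z → u ∸ δ z) (trans (cong (_∧ (m + m <ᵇ c + u)) (≡true (≤ᵇT c≤2m))) b2) ⟩
      u ∸ δ (m <ᵇ 2 * u) ∎
    where
    open ≡-Reasoning
    e1 : c + u ≡ m + 2 * u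
    e1 = trans (cong (_+ u) c≡m+u) (trans (+-assoc m u u) (cong (m +_) (cong (u +_) (sym (+-identityʳ u)))))
    b2 : (m + m <ᵇ c + u) ≡ (m <ᵇ 2 * u)
    b2 = bool-ext (λ t → <ᵇT (+-cancelˡ-< m m (2 * u) (subst (m + m <_) e1 (T<ᵇ t))))
                  (λ t → <ᵇT (subst (m + m <_) (sym e1) (+-monoʳ-< m (T<ᵇ t))))

  seed₁-without? : ℕ → ℕ → Bool
  seed₁-without? x y = noDecomp (M-without x) m y

  revived? : ℕ → ℕ → Bool
  revived? x y = rg? y ∧ not (seed₁? y) ∧ seed₁-without? x y

  decomposition-without : ∀ x y a → c ≤ a → a + a ≤ y + m → a ≢ x → (y + m ∸ a) ≢ x → Decomposition (M-without x) m y
  decomposition-without x y a ca aa ax bx = a , y + m ∸ a , T∧ (M-≥c a ca) (Tnot (λ t → ax (T≡ᵇ t))) ,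
      T∧ (M-≥c (y + m ∸ a) (≤-trans ca a≤b)) (Tnot (λ t → bx (T≡ᵇ t))) , <-≤-trans m<c ca , a≤b , b<y , eq
    where
    a≤ym : a ≤ y + m
    a≤ym = ≤-trans (m≤m+n a a) aa
    eq : a + (y + m ∸ a) ≡ y + m
    eq = m+[n∸m]≡n a≤ym
    a≤b : a ≤ y + m ∸ a
    a≤b = +-cancelˡ-≤ a a (y + m ∸ a) (subst (a + a ≤_) (sym eq) aa)
    b<y : y + m ∸ a < y
    b<y = +-cancelˡ-< a (y + m ∸ a) y (subst (_< a + y) (sym eq) (subst (y + m <_) (+-comm y a) (+-monoʳ-< y (<-≤-trans m<c ca))))

  seed₁-without-true : ∀ x y → y + m ≤ suc (c + c) → (c ≡ x ⊎ y + m ≡ c + x) → T (seed₁-without? x y)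
  seed₁-without-true x y le h = noDecomp-complete (M-without x) m y (go h)
    where
    go : (c ≡ x ⊎ y + m ≡ c + x) → ¬ Decomposition (M-without x) m y
    go h (a , b , ma , mb , pa , ab , by , e) with m≤n⇒m<n∨m≡n (member>m⇒c≤ a (proj₁ (and2 (M a) _ ma)) pa)
    ... | inj₁ c<a = <-irrefl refl (<-≤-trans (s≤s le) (subst (suc (suc (c + c)) ≤_) e
                        (subst (_≤ a + b) (cong suc (+-suc c c)) (+-mono-≤ c<a (<-≤-trans c<a ab)))))
    ... | inj₂ refl with h
    ...   | inj₁ cx = Tnot⁻ (proj₂ (and2 (M c) _ ma)) (≡ᵇT cx)
    ...   | inj₂ e2 = Tnot⁻ (proj₂ (and2 (M b) _ mb)) (≡ᵇT (+-cancelˡ-≡ c b x (trans e e2)))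

  decomposition-without-≥c+2 : ∀ x y → c + 2 ≤ x → c + c ≤ y + m → Decomposition (M-without x) m y
  decomposition-without-≥c+2 x y cx le with (y + m ∸ c) ≟ x
  ... | no ne = decomposition-without x y c ≤-refl le (λ e → <-irrefl e (<-≤-trans (m<m+n c (s≤s z≤n)) cx)) ne
  ... | yes e = decomposition-without x y (suc c) (n≤1+n c) c+[2+u]≤ (λ q → <-irrefl q (<-≤-trans (subst (_< c + 2) (+-comm c 1) (+-monoʳ-< c (s≤s (s≤s z≤n)))) cx))
                  (λ q → <-irrefl q (subst (_< x) (sym e3) pred<))
    where
    c≤ym : c ≤ y + m
    c≤ym = ≤-trans (m≤m+n c c) le
    e2 : y + m ≡ c + x
    e2 = trans (sym (m+[n∸m]≡n c≤ym)) (cong (c +_) e)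
    c+[2+u]≤ : suc c + suc c ≤ y + m
    c+[2+u]≤ = subst (_≤ y + m) (c+[c+2]≡[1+c]+[1+c] c) (subst (c + (c + 2) ≤_) (sym e2) (+-monoʳ-≤ c cx))
    e3 : y + m ∸ suc c ≡ x ∸ 1
    e3 = trans (cong (_∸ suc c) e2) (trans (cong (c + x ∸_) (+-comm 1 c)) (trans (sym (∸-+-assoc (c + x) c 1)) (cong (_∸ 1) (m+n∸m≡n c x))))
    pred< : x ∸ 1 < x
    pred< = ∸-monoʳ-< (s≤s z≤n) (≤-trans (s≤s z≤n) (≤-trans (m≤n+m 2 c) cx))

  rg?-c+ : ∀ z → z < m → rg? (c + z) ≡ not (u + z ≡ᵇ m)
  rg?-c+ z zm = trans (rg?≡not-2m (c + z) (m≤m+n c z) (+-monoʳ-< c zm)) (cong not (bool-ext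
     (λ t → ≡ᵇT (+-cancelˡ-≡ m (u + z) m (trans (sym (+-assoc m u z)) (trans (cong (_+ z) (sym c≡m+u)) (T≡ᵇ t)))))
     (λ t → ≡ᵇT (trans (cong (_+ z) c≡m+u) (trans (+-assoc m u z) (cong (m +_) (T≡ᵇ t)))))))

  rg?-≥c+m : ∀ z → m ≤ z → rg? (c + z) ≡ false
  rg?-≥c+m z mz = Tfalse (λ t → <-irrefl refl (<-≤-trans (rightGen<c+m c≥1 (c + z) (isRightGen-sound _ t)) (+-monoʳ-≤ c mz)))

  seed₁?-false : ∀ y → c + u ≤ y → seed₁? y ≡ false
  seed₁?-false y le = trans (seed₁?≡<c+u y (≤-trans (m≤m+n c u) le)) (Tfalse (λ t → <-irrefl refl (<-≤-trans (T<ᵇ t) le)))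

  seed₁?-true : ∀ y → c ≤ y → y < c + u → seed₁? y ≡ true
  seed₁?-true y cy lt = trans (seed₁?≡<c+u y cy) (≡true (<ᵇT lt))

  le-∸ : ∀ a s → a + a ≤ s → a ≤ s ∸ a
  le-∸ a s h = +-cancelˡ-≤ a a (s ∸ a) (subst (a + a ≤_) (sym (m+[n∸m]≡n (≤-trans (m≤m+n a a) h))) h)

  decomposition-without-c : ∀ y → c + suc (suc u) ≤ y → Decomposition (M-without c) m y
  decomposition-without-c y le = decomposition-without c y (suc c) (n≤1+n c) c+[2+u]≤ (λ e → <-irrefl (sym e) (n<1+n c)) ne
    where
    c+[2+u]≤ : suc c + suc c ≤ y + m
    c+[2+u]≤ = subst (_≤ y + m) (trans (c+[2+u]+m≡c+u+m+2 c u m) (trans (cong (_+ 2) (sym c+c≡c+u+m)) (c+c+2≡[1+c]+[1+c] c))) (+-monoˡ-≤ m le)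
    ne : y + m ∸ suc c ≢ c
    ne e = <-irrefl (sym e) (le-∸ (suc c) (y + m) c+[2+u]≤)

  δ3F : ∀ a b → δ (a ∧ b ∧ false) ≡ 0
  δ3F true true = refl
  δ3F true false = refl
  δ3F false b = refl

  δ2F : ∀ a b → δ (a ∧ false ∧ b) ≡ 0
  δ2F true b = refl
  δ2F false b = refl

  ∧tt : ∀ a → a ∧ true ∧ true ≡ a
  ∧tt true = refl
  ∧tt false = refl

  c+u+m≡c+c : c + u + m ≡ c + c
  c+u+m≡c+c = sym c+c≡c+u+m

  seed₁-without-c-c+u : T (seed₁-without? c (c + u))
  seed₁-without-c-c+u = seed₁-without-true c (c + u) (≤-trans (≤-reflexive c+u+m≡c+c) (n≤1+n _)) (inj₁ refl)

  c+[1+u]+m≡1+c+c : c + suc u + m ≡ suc (c + c)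
  c+[1+u]+m≡1+c+c = trans (cong (_+ m) (+-suc c u)) (cong suc c+u+m≡c+c)

  seed₁-without-c+1+u : ∀ x → (c ≡ x ⊎ c + suc u + m ≡ c + x) → T (seed₁-without? x (c + suc u))
  seed₁-without-c+1+u x h = seed₁-without-true x (c + suc u) (≤-reflexive c+[1+u]+m≡1+c+c) h

  c+u<c+[1+u] : c + u < c + suc u
  c+u<c+[1+u] = +-monoʳ-< c (n<1+n u)

  c+[2+u]≤ : ∀ y → c + u < y → y ≢ c + suc u → c + suc (suc u) ≤ y
  c+[2+u]≤ y gt ne = subst (_≤ y) (sym (+-suc c (suc u))) (≤∧≢⇒< (subst (_≤ y) (sym (+-suc c u)) gt) (λ e → ne (sym e)))

  revived?-c : ∀ y → suc c ≤ y → δ (revived? c y) ≡ δ ((y ≡ᵇ c + u) ∧ rg? (c + u)) + δ ((y ≡ᵇ c + suc u) ∧ rg? (c + suc u))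
  revived?-c y cy with <-cmp y (c + u)
  ... | tri< lt _ _ rewrite seed₁?-true y (≤-trans (n≤1+n c) cy) lt | ≢⇒≡ᵇ≡false (<⇒≢ lt) | ≢⇒≡ᵇ≡false (<⇒≢ (<-trans lt c+u<c+[1+u])) = δ2F (rg? y) (seed₁-without? c y)
  ... | tri≈ _ refl _ rewrite seed₁?-false (c + u) ≤-refl | ≡true seed₁-without-c-c+u | ≡ᵇ-refl (c + u) | ≢⇒≡ᵇ≡false (<⇒≢ c+u<c+[1+u]) =
          trans (cong δ (∧tt (rg? (c + u)))) (sym (+-identityʳ _))
  ... | tri> _ _ gt with y ≟ c + suc u
  ...   | yes refl rewrite seed₁?-false (c + suc u) (<⇒≤ c+u<c+[1+u]) | ≡true (seed₁-without-c+1+u c (inj₁ refl)) | ≡ᵇ-refl (c + suc u) | ≢⇒≡ᵇ≡false (≢-sym (<⇒≢ c+u<c+[1+u])) = cong δ (∧tt (rg? (c + suc u)))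
  ...   | no ne rewrite noDecomp-false (M-without c) m y (decomposition-without-c y (c+[2+u]≤ y gt ne)) | ≢⇒≡ᵇ≡false (≢-sym (<⇒≢ gt)) | ≢⇒≡ᵇ≡false ne = δ3F (rg? y) (not (seed₁? y))

  c+[1+c]≡1+c+c : c + suc c ≡ suc (c + c)
  c+[1+c]≡1+c+c = +-suc c c

  decomposition-without-c+1 : ∀ y → c + u < y → y ≢ c + suc u → Decomposition (M-without (suc c)) m y
  decomposition-without-c+1 y gt ne = dec
    where
    le3 : suc (suc (c + c)) ≤ y + m
    le3 = subst (_≤ y + m) (trans (c+[2+u]+m≡c+u+m+2 c u m) (trans (cong (_+ 2) (sym c+c≡c+u+m)) (+-comm (c + c) 2))) (+-monoˡ-≤ m (c+[2+u]≤ y gt ne))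
    dec : Decomposition (M-without (suc c)) m y
    dec = decomposition-without (suc c) y c ≤-refl (≤-trans (n≤1+n _) (≤-trans (n≤1+n _) le3)) (λ e → <-irrefl e (n<1+n c))
            (λ e → <-irrefl (sym e) (subst (suc c <_) refl (+-cancelˡ-< c (suc c) (y + m ∸ c)
                (subst (c + suc c <_) (sym (m+[n∸m]≡n (≤-trans (m≤m+n c c) (≤-trans (n≤1+n _) (≤-trans (n≤1+n _) le3)))))
                   (subst (_< y + m) (sym c+[1+c]≡1+c+c) le3)))))

  revived?-c+1 : ∀ y → suc (suc c) ≤ y → δ (revived? (suc c) y) ≡ δ ((y ≡ᵇ c + suc u) ∧ rg? (c + suc u))
  revived?-c+1 y cy with <-cmp y (c + u)
  ... | tri< lt _ _ rewrite seed₁?-true y (≤-trans (≤-trans (n≤1+n c) (n≤1+n (suc c))) cy) lt | ≢⇒≡ᵇ≡false (<⇒≢ (<-trans lt c+u<c+[1+u])) = δ2F (rg? y) (seed₁-without? (suc c) y)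
  ... | tri≈ _ refl _ rewrite noDecomp-false (M-without (suc c)) m (c + u) (decomposition-without (suc c) (c + u) c ≤-refl (≤-reflexive (sym c+u+m≡c+c)) (λ e → <-irrefl e (n<1+n c))
                        (λ e → <-irrefl (trans (sym (+≡⇒∸≡ (sym c+u+m≡c+c))) e) (n<1+n c))) | ≢⇒≡ᵇ≡false (<⇒≢ c+u<c+[1+u]) = δ3F (rg? (c + u)) (not (seed₁? (c + u)))
  ... | tri> _ _ gt with y ≟ c + suc u
  ...   | yes refl rewrite seed₁?-false (c + suc u) (<⇒≤ c+u<c+[1+u]) | ≡true (seed₁-without-c+1+u (suc c) (inj₂ (trans c+[1+u]+m≡1+c+c (sym c+[1+c]≡1+c+c)))) | ≡ᵇ-refl (c + suc u) = cong δ (∧tt (rg? (c + suc u)))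
  ...   | no ne rewrite noDecomp-false (M-without (suc c)) m y (decomposition-without-c+1 y gt ne) | ≢⇒≡ᵇ≡false ne = δ3F (rg? y) (not (seed₁? y))

  topSeed-c : topSeed c ≡ δ (m ≤ᵇ suc u)
  topSeed-c with m ≤? suc u
  ... | yes le = trans (cong δ (cong₂ _∧_ (seed₁?-true c ≤-refl (m<m+n c u≥1)) (≡true (seed₁-without-true c (c + m) le4 (inj₁ refl)))))
                   (cong δ (sym (≡true (≤ᵇT le))))
    where
    le4 : c + m + m ≤ suc (c + c)
    le4 = subst (_≤ suc (c + c)) (sym (+-assoc c m m)) (subst (c + (m + m) ≤_) c+[1+c]≡1+c+c (+-monoʳ-≤ c (subst (m + m ≤_) (trans (+-suc m u) (cong suc (sym c≡m+u))) (+-monoʳ-≤ m le))))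
  ... | no gt = trans (cong δ (cong (seed₁? c ∧_) (noDecomp-false (M-without c) m (c + m) (decomposition-without-c (c + m) (+-monoʳ-≤ c (≰⇒> gt))))))
                  (trans (δ-∧-false (seed₁? c)) (cong δ (sym (Tfalse (λ t → gt (T≤ᵇ t))))))

  topSeed-c+1 : topSeed (suc c) ≡ δ (u ≡ᵇ m)
  topSeed-c+1 with m≤n⇒m<n∨m≡n u≤m
  ... | inj₂ e = trans (cong δ (cong₂ _∧_ (seed₁?-true (suc c) (n≤1+n c) (subst (suc c <_) refl (subst (_< c + u) (+-comm c 1) (+-monoʳ-< c u≥2))))
                      (≡true (seed₁-without-true (suc c) (suc c + m) (≤-reflexive e5) (inj₂ (trans e5 (sym c+[1+c]≡1+c+c)))))))
                   (cong δ (sym (≡true (≡ᵇT e))))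
    where
    u≥2 : 1 < u
    u≥2 = subst (1 <_) (sym e) m≥2
    e5 : suc c + m + m ≡ suc (c + c)
    e5 = cong suc (trans (+-assoc c m m) (cong (c +_) (trans (sym (cong (m +_) e)) (sym c≡m+u))))
  ... | inj₁ lt = trans (cong δ (cong (seed₁? (suc c) ∧_) (noDecomp-false (M-without (suc c)) m (suc c + m) dec))) (trans (δ-∧-false (seed₁? (suc c))) (cong δ (sym (≢⇒≡ᵇ≡false (<⇒≢ lt)))))
    where
    le6 : c + c ≤ suc c + m + m
    le6 = ≤-trans (+-monoʳ-≤ c c≤2m) (≤-trans (n≤1+n _) (≤-reflexive (cong suc (sym (+-assoc c m m)))))
    e6 : suc c + m + m ∸ c ≡ suc (m + m)
    e6 = +≡⇒∸≡ (sym (1+c+m+m≡c+[1+m+m] c m))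
    c<2m : c < m + m
    c<2m = subst (_< m + m) (sym c≡m+u) (+-monoʳ-< m lt)
    dec : Decomposition (M-without (suc c)) m (suc c + m)
    dec = decomposition-without (suc c) (suc c + m) c ≤-refl le6 (λ e → <-irrefl e (n<1+n c))
            (λ e → <-irrefl (sym (suc-injective (trans (sym e6) e))) c<2m)

  ptval : ∀ s z → s ≤ c + z → s ≤ c + m → δ (rg? (c + z) ∧ (s ≤ᵇ c + z) ∧ (c + z <ᵇ s + (c + m ∸ s))) ≡ δ ((z <ᵇ m) ∧ not (u + z ≡ᵇ m))
  ptval s z sz sm' rewrite ≡true (≤ᵇT sz) | m+[n∸m]≡n sm' with z <? m
  ... | yes zm rewrite rg?-c+ z zm | ≡true (<ᵇT (+-monoʳ-< c zm)) | ≡true (<ᵇT zm) = cong δ (∧tt (not (u + z ≡ᵇ m)))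
  ... | no zm rewrite rg?-≥c+m z (≮⇒≥ zm) | Tfalse (λ t → zm (T<ᵇ t)) = refl

  revivedSeeds-c : revivedSeeds c ≡ δ ((u <ᵇ m) ∧ not (u + u ≡ᵇ m)) + δ ((suc u <ᵇ m) ∧ not (u + suc u ≡ᵇ m))
  revivedSeeds-c = begin
      revivedSeeds c ≡⟨ sumFrom-cong (suc c) L (λ y p _ → revived?-c y p) ⟩
      sumFrom (λ y → δ ((y ≡ᵇ c + u) ∧ rg? (c + u)) + δ ((y ≡ᵇ c + suc u) ∧ rg? (c + suc u))) (suc c) L
        ≡⟨ sumFrom-+ (λ y → δ ((y ≡ᵇ c + u) ∧ rg? (c + u))) (λ y → δ ((y ≡ᵇ c + suc u) ∧ rg? (c + suc u))) (suc c) L ⟩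
      countFrom (λ y → (y ≡ᵇ c + u) ∧ rg? (c + u)) (suc c) L + countFrom (λ y → (y ≡ᵇ c + suc u) ∧ rg? (c + suc u)) (suc c) L
        ≡⟨ cong₂ _+_ (countFrom-≡ᵇ-∧ (c + u) (rg? (c + u)) (suc c) L) (countFrom-≡ᵇ-∧ (c + suc u) (rg? (c + suc u)) (suc c) L) ⟩
      _ ≡⟨ cong₂ _+_ (ptval (suc c) u (subst (_≤ c + u) (+-comm c 1) (+-monoʳ-≤ c u≥1)) sc≤) (ptval (suc c) (suc u) (subst (_≤ c + suc u) (+-comm c 1) (+-monoʳ-≤ c (s≤s z≤n))) sc≤) ⟩
      δ ((u <ᵇ m) ∧ not (u + u ≡ᵇ m)) + δ ((suc u <ᵇ m) ∧ not (u + suc u ≡ᵇ m)) ∎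
    where
    open ≡-Reasoning
    L = c + m ∸ suc c
    sc≤ : suc c ≤ c + m
    sc≤ = subst (_≤ c + m) (+-comm c 1) (+-monoʳ-≤ c m>0)

  revivedSeeds-c+1 : revivedSeeds (suc c) ≡ δ ((suc u <ᵇ m) ∧ not (u + suc u ≡ᵇ m))
  revivedSeeds-c+1 = begin
      revivedSeeds (suc c) ≡⟨ sumFrom-cong (suc (suc c)) L (λ y p _ → revived?-c+1 y p) ⟩
      countFrom (λ y → (y ≡ᵇ c + suc u) ∧ rg? (c + suc u)) (suc (suc c)) L ≡⟨ countFrom-≡ᵇ-∧ (c + suc u) (rg? (c + suc u)) (suc (suc c)) L ⟩
      _ ≡⟨ ptval (suc (suc c)) (suc u) (subst (_≤ c + suc u) (+-comm c 2) (+-monoʳ-≤ c (s≤s u≥1))) ssc≤ ⟩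
      δ ((suc u <ᵇ m) ∧ not (u + suc u ≡ᵇ m)) ∎
    where
    open ≡-Reasoning
    L = c + m ∸ suc (suc c)
    ssc≤ : suc (suc c) ≤ c + m
    ssc≤ = subst (_≤ c + m) (+-comm c 2) (+-monoʳ-≤ c m≥2)

  extraSeedsAt : ℕ → ℕ
  extraSeedsAt x = if rg? x then revivedSeeds x + topSeed x else 0

  if-0+0 : ∀ b → (if b then 0 + 0 else 0) ≡ 0
  if-0+0 true = refl
  if-0+0 false = refl

  not-revived-≥c+2 : ∀ x y → c + 2 ≤ x → suc x ≤ y → ¬ T (rg? y ∧ not (seed₁? y) ∧ noDecomp (M-without x) m y)
  not-revived-≥c+2 x y cx p t with and3 (rg? y) (not (seed₁? y)) (noDecomp (M-without x) m y) t
  ... | _ , t2 , t3 = noDecomp-sound (M-without x) m y t3 (decomposition-without-≥c+2 x y cx le)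
    where
    c≤x : c ≤ x
    c≤x = ≤-trans (m≤m+n c 2) cx
    cuy : c + u ≤ y
    cuy with c + u ≤? y
    ... | yes q = q
    ... | no q = ⊥-elim (Tnot⁻ t2 (subst T (sym (seed₁?-true y (≤-trans c≤x (≤-trans (n≤1+n x) p)) (≰⇒> q))) tt))
    le : c + c ≤ y + m
    le = subst (_≤ y + m) c+u+m≡c+c (+-monoˡ-≤ m cuy)

  revivedSeeds-≥c+2 : ∀ x → c + 2 ≤ x → revivedSeeds x ≡ 0
  revivedSeeds-≥c+2 x cx = countFrom-none (λ y → rg? y ∧ not (seed₁? y) ∧ noDecomp (M-without x) m y) (suc x) (c + m ∸ suc x) (λ y p _ t → not-revived-≥c+2 x y cx p t)

  topSeed-≥c+2 : ∀ x → c + 2 ≤ x → topSeed x ≡ 0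
  topSeed-≥c+2 x cx = trans (cong (λ b → δ (seed₁? x ∧ b)) (noDecomp-false (M-without x) m (x + m) (decomposition-without-≥c+2 x (x + m) cx le))) (δ-∧-false (seed₁? x))
    where
    le : c + c ≤ x + m + m
    le = subst (c + c ≤_) (sym (+-assoc x m m)) (+-mono-≤ (≤-trans (m≤m+n c 2) cx) c≤2m)

  extraSeedsAt-≥c+2 : ∀ x → c + 2 ≤ x → extraSeedsAt x ≡ 0
  extraSeedsAt-≥c+2 x cx = trans (cong₂ (λ a b → if rg? x then a + b else 0) (revivedSeeds-≥c+2 x cx) (topSeed-≥c+2 x cx)) (if-0+0 (rg? x))

  rg?-c : rg? c ≡ not (u ≡ᵇ m)
  rg?-c = trans (cong rg? (sym (+-identityʳ c))) (trans (rg?-c+ 0 m>0) (cong (λ z → not (z ≡ᵇ m)) (+-identityʳ u)))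

  rg?-c+1 : rg? (suc c) ≡ not (suc u ≡ᵇ m)
  rg?-c+1 = trans (cong rg? (+-comm 1 c)) (trans (rg?-c+ 1 (≤-trans (s≤s (s≤s z≤n)) m≥2)) (cong (λ z → not (z ≡ᵇ m)) (+-comm u 1)))

  extraSeeds-rank2 : extraSeeds ≡ (if not (u ≡ᵇ m) then δ ((u <ᵇ m) ∧ not (u + u ≡ᵇ m)) + δ ((suc u <ᵇ m) ∧ not (u + suc u ≡ᵇ m)) + δ (m ≤ᵇ suc u) else 0)
             + (if not (suc u ≡ᵇ m) then δ ((suc u <ᵇ m) ∧ not (u + suc u ≡ᵇ m)) + δ (u ≡ᵇ m) else 0)
  extraSeeds-rank2 = begin
      extraSeeds ≡⟨ cong (sumFrom extraSeedsAt c) (sym (m+[n∸m]≡n m≥2)) ⟩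
      sumFrom extraSeedsAt c (2 + (m ∸ 2)) ≡⟨ sumFrom-split extraSeedsAt c 2 (m ∸ 2) ⟩
      sumFrom extraSeedsAt c 2 + sumFrom extraSeedsAt (c + 2) (m ∸ 2) ≡⟨ cong (sumFrom extraSeedsAt c 2 +_) (sumFrom-zero (c + 2) (m ∸ 2) (λ x p _ → extraSeedsAt-≥c+2 x p)) ⟩
      extraSeedsAt c + (extraSeedsAt (suc c) + 0) + 0 ≡⟨ trans (+-identityʳ _) (cong (extraSeedsAt c +_) (+-identityʳ _)) ⟩
      extraSeedsAt c + extraSeedsAt (suc c) ≡⟨ cong₂ _+_ (cong₂ (λ b e → if b then e else 0) rg?-c (cong₂ _+_ revivedSeeds-c topSeed-c))
                                   (cong₂ (λ b e → if b then e else 0) rg?-c+1 (cong₂ _+_ revivedSeeds-c+1 topSeed-c+1)) ⟩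
      _ ∎
    where open ≡-Reasoning

  nChildren-rank2 : nChildren R ≡ m ∸ 1
  nChildren-rank2 = trans (nChildren≡nGens c≥1) nGens≡m∸1

  nGreatGrandchildren-rank2 :
    nGreatGrandchildren R ≡ (m ∸ 1) C 3 + (u ∸ δ (m <ᵇ 2 * u)) * (m ∸ 2) + δ ((u ≡ᵇ m) ∨ not (2 * u ≡ᵇ m))
                            + 2 * δ ((u <ᵇ m ∸ 1) ∧ not (2 * u + 1 ≡ᵇ m)) + δ (u ≡ᵇ m ∸ 1)
  nGreatGrandchildren-rank2 = begin
      nGreatGrandchildren R ≡⟨ nGreatGrandchildren≡ ⟩
      nGens C 3 + nSeedGens * (nGens ∸ 1) + extraSeeds
        ≡⟨ cong₂ (λ a b → a C 3 + b * (a ∸ 1) + extraSeeds) nGens≡m∸1 nSeedGens≡ ⟩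
      (m ∸ 1) C 3 + (u ∸ δ (m <ᵇ 2 * u)) * (m ∸ 1 ∸ 1) + extraSeeds
        ≡⟨ cong₂ (λ a b → (m ∸ 1) C 3 + (u ∸ δ (m <ᵇ 2 * u)) * a + b) (∸-+-assoc m 1 1)
                 (trans extraSeeds-rank2 (extraSeeds-rank2-closed m u u≥1 u≤m m≥2)) ⟩
      base + (δb + 2 * δc + δd) ≡⟨ sym (+-assoc base (δb + 2 * δc) δd) ⟩
      base + (δb + 2 * δc) + δd ≡⟨ cong (_+ δd) (sym (+-assoc base δb (2 * δc))) ⟩
      base + δb + 2 * δc + δd ∎
    where
    open ≡-Reasoning
    base = (m ∸ 1) C 3 + (u ∸ δ (m <ᵇ 2 * u)) * (m ∸ 2)
    δb = δ ((u ≡ᵇ m) ∨ not (2 * u ≡ᵇ m))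
    δc = δ ((u <ᵇ m ∸ 1) ∧ not (2 * u + 1 ≡ᵇ m))
    δd = δ (u ≡ᵇ m ∸ 1)

-- Rank 1

3+c<ᵇc+m≡3<ᵇm : ∀ c m → (suc (suc (suc c)) <ᵇ c + m) ≡ (3 <ᵇ m)
3+c<ᵇc+m≡3<ᵇm c m = bool-ext (λ t → <ᵇT (+-cancelˡ-< c 3 m (subst (_< c + m) (+-comm 3 c) (T<ᵇ {suc (suc (suc c))} {c + m} t))))
                  (λ t → <ᵇT (subst (_< c + m) (+-comm c 3) (+-monoʳ-< c (T<ᵇ {3} {m} t))))

-- The sum of `correction` below with m = n: the children removing c, c + 1 and c + 2 give the three terms.
rank1-correction : ℕ → ℕ → ℕ
rank1-correction n c = (n + (n ∸ 1) + 3) * 1 + ((n ∸ 2) + (2 ∸ δ (n <ᵇ 2 * 2))) * 1 + δ ((3 <ᵇ n) ∧ (c ≤ᵇ suc (suc c)) ∧ (suc (suc c) <ᵇ c + n))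

rank1-correction-small : ∀ n c → (n ≡ 2 ⊎ n ≡ 3) → rank1-correction n c ≡ 3 * n + 1
rank1-correction-small .2 c (inj₁ refl) = refl
rank1-correction-small .3 c (inj₂ refl) = refl

rank1-correction-large-identity : ∀ n → (4 + n + (3 + n) + 3) * 1 + (2 + n + 2) * 1 + 1 ≡ 3 * (4 + n) + 3
rank1-correction-large-identity = solve-∀

rank1-correction-large : ∀ n c → 4 ≤ n → rank1-correction n c ≡ 3 * n + 3
rank1-correction-large zero c ()
rank1-correction-large (suc zero) c (s≤s ())
rank1-correction-large (suc (suc zero)) c (s≤s (s≤s ()))
rank1-correction-large (suc (suc (suc zero))) c (s≤s (s≤s (s≤s ())))
rank1-correction-large (suc (suc (suc (suc n)))) c _ rewrite ≡true (≤ᵇT (≤-trans (n≤1+n c) (n≤1+n (suc c))))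
   | ≡true (<ᵇT (subst (_< c + suc (suc (suc (suc n)))) (+-comm c 2) (+-monoʳ-< c (s≤s (s≤s (s≤s (z≤n {suc n}))))))) = rank1-correction-large-identity n

a≡a*1+b*0+0 : ∀ a b → a ≡ a * 1 + b * 0 + 0
a≡a*1+b*0+0 = solve-∀
b≡a*0+b*1+0 : ∀ a b → b ≡ a * 0 + b * 1 + 0
b≡a*0+b*1+0 = solve-∀
d≡a*0+b*0+d : ∀ a b d → d ≡ a * 0 + b * 0 + d
d≡a*0+b*0+d = solve-∀
m+[p+q]+3≡q+[m+p+3] : ∀ m p q → m + (p + q) + 3 ≡ q + (m + p + 3)
m+[p+q]+3≡q+[m+p+3] = solve-∀
3+c+c≡1+[2+c+1+c] : ∀ c → suc (suc (suc c)) + c ≡ suc (suc c + suc c)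
3+c+c≡1+[2+c+1+c] = solve-∀
4+c+c≡[2+c]+[2+c] : ∀ c → suc (suc (suc (suc c))) + c ≡ suc (suc c) + suc (suc c)
4+c+c≡[2+c]+[2+c] = solve-∀

module Rank1 (Λ : NumericalSemigroup) (k≡1 : Basics.k Λ ≡ 1) where
  open Basics Λ

  m≡c : m ≡ c
  m≡c = trans (cong (elt R) (sym k≡1)) elt-rank

  c≥1 : 1 ≤ c
  c≥1 = subst (1 ≤_) m≡c m>0

  m≥2 : 2 ≤ m
  m≥2 with m | m>0 | m≡c
  ... | suc zero | _ | e = ⊥-elim (conductor-gap 0 (sym e) M-0)
  ... | suc (suc _) | _ | _ = s≤s (s≤s z≤n)

  nonzero-member⇒c≤ : ∀ x → T (M x) → x ≢ 0 → c ≤ x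
  nonzero-member⇒c≤ x mx ne = subst (_≤ x) m≡c (m-minimal x mx ne)

  rg?-all : ∀ x → c ≤ x → x < c + m → T (rg? x)
  rg?-all x cx xcm = isRightGen-complete x (cx , (λ e → <-irrefl (sym e) (≤-trans c≥1 cx)) , M-≥c x cx , nd)
    where
    nd : ¬ Decomposition M 0 x
    nd (a , b , ma , mb , pa , ab , bx , e) = <-irrefl refl (<-≤-trans xcm
      (subst (c + m ≤_) (trans e (+-identityʳ x)) (+-mono-≤ (nonzero-member⇒c≤ a ma (λ q → <-irrefl (sym q) pa)) (subst (_≤ b) (sym m≡c) (nonzero-member⇒c≤ b mb (λ q → <-irrefl (sym q) (<-≤-trans pa ab)))))))

  nGens≡m : nGens ≡ m
  nGens≡m = countFrom-all rg? c m (λ x p q → rg?-all x p q)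

  nChildren-rank1 : nChildren R ≡ m
  nChildren-rank1 = trans (nChildren≡nGens c≥1) nGens≡m

  seed₁?≡<c+2 : ∀ x → c ≤ x → noDecomp M m x ≡ (x <ᵇ c + 2)
  seed₁?≡<c+2 x cx with x <? c + 2
  ... | yes lt = trans (≡true (noDecomp-complete M m x nd)) (sym (≡true (<ᵇT lt)))
    where
    nd : ¬ Decomposition M m x
    nd (a , b , ma , mb , pa , ab , bx , e) = <-irrefl refl (<-≤-trans (≤-<-trans (<-≤-trans (subst (_< a) m≡c pa) ab) bx) (≤-pred (subst (x <_) (+-comm c 2) lt)))
  ... | no ge = trans (Tfalse (λ t → noDecomp-sound M m x t dec)) (sym (Tfalse (λ t → ge (T<ᵇ t))))
    where
    ge' : c + 2 ≤ x
    ge' = ≮⇒≥ ge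
    x1 : 1 ≤ x
    x1 = ≤-trans (s≤s z≤n) (≤-trans (m≤n+m 2 c) ge')
    dec : Decomposition M m x
    dec = suc m , x ∸ 1 , M-≥c (suc m) (subst (_≤ suc m) m≡c (n≤1+n m)) , M-≥c (x ∸ 1) c≤ ,
          n<1+n m , sm≤ , ∸-monoʳ-< (s≤s z≤n) x1 , trans (sym (+-suc m (x ∸ 1))) (trans (cong (m +_) (m+[n∸m]≡n x1)) (+-comm m x))
      where
      c≤ : c ≤ x ∸ 1
      c≤ = subst (_≤ x ∸ 1) (m+n∸n≡m c 1) (∸-monoˡ-≤ 1 (≤-trans (+-monoʳ-≤ c (s≤s z≤n)) ge'))
      sm≤ : suc m ≤ x ∸ 1
      sm≤ = subst (_≤ x ∸ 1) (trans (cong (_∸ 1) (+-comm c 2)) (sym (cong suc m≡c))) (∸-monoˡ-≤ 1 ge')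

  c<cm : c < c + m
  c<cm = m<m+n c m>0

  rg?-c : T (rg? c)
  rg?-c = rg?-all c ≤-refl c<cm

  module ChildAtC = Child Λ c rg?-c

  rank-childAtC : Basics.k ChildAtC.Λ' ≡ 1
  rank-childAtC = trans ChildAtC.rank' (trans (sym rank≡count) k≡1)

  count-childAtC : countFrom ChildAtC.S'.M 0 (suc c) ≡ 1
  count-childAtC = trans (countFrom-suc-false ChildAtC.S'.M c (λ t → ChildAtC.M'₂ t refl)) (trans (ChildAtC.count'-below c ≤-refl) (trans (sym rank≡count) k≡1))

  m-childAtC : Basics.m ChildAtC.Λ' ≡ suc m
  m-childAtC = trans (cong (elt ChildAtC.S'.R) (sym count-childAtC)) (trans (ChildAtC.S'.elt-count (ChildAtC.M'-intro (M-≥c (suc c) (n≤1+n c)) (λ e → <-irrefl (sym e) (n<1+n c)))) (cong suc (sym m≡c)))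

  gensAbove-c : gensAbove c ≡ m ∸ 1
  gensAbove-c = trans (countFrom-all rg? (suc c) (c + m ∸ suc c) (λ x p q → rg?-all x (≤-trans (n≤1+n c) p) (subst (x <_) (m+[n∸m]≡n c<cm) q)))
              (trans (cong (_∸ suc c) (+-comm c m)) (trans (cong (m + c ∸_) (+-comm 1 c)) (trans (sym (∸-+-assoc (m + c) c 1)) (cong (_∸ 1) (m+n∸n≡m m c)))))

module Rank1Grandchildren (Λ : NumericalSemigroup) (k≡1 : Basics.k Λ ≡ 1) where
  open Basics Λ
  open Rank1 Λ k≡1
  open DescendantSums Λ

  nChildren-childAtC : nChildren (remove R c) ≡ suc m
  nChildren-childAtC = trans (ChildAtC.S'.nChildren≡nGens (subst (1 ≤_) (sym ChildAtC.conductor') (s≤s z≤n))) (trans (Rank1.nGens≡m ChildAtC.Λ' rank-childAtC) m-childAtC)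

  bonus : ℕ → ℕ
  bonus x = 2 * δ (x ≡ᵇ c) + δ (x ≡ᵇ suc c)

  nChildren-child : ∀ x → c ≤ x → x < c + m → nChildren (remove R x) ≡ gensAbove x + bonus x
  nChildren-child x cx xcm with c ≟ x
  ... | yes refl rewrite ≡ᵇ-refl c | ≢⇒≡ᵇ≡false {c} {suc c} (<⇒≢ (n<1+n c)) = trans nChildren-childAtC (trans (sym (trans (cong (_+ 2) gensAbove-c) (trans (+-comm (m ∸ 1) 2) (cong suc (m+[n∸m]≡n m>0))))) refl)
  ... | no ne = trans (C.S'.nChildren≡nGens (subst (1 ≤_) (sym C.conductor') (s≤s z≤n))) (trans (C.nGens'≡ (subst (_< x) (sym m≡c) c<x) c≥1)
                  (cong (gensAbove x +_) (trans (cong δ (seed₁?≡<c+2 x cx)) (sym (trans (cong (_+ δ (x ≡ᵇ suc c)) (cong (2 *_) (cong δ (≢⇒≡ᵇ≡false (≢-sym ne))))) (lem x c<x))))))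
    where
    c<x : c < x
    c<x = ≤∧≢⇒< cx ne
    module C = Child Λ x (rg?-all x cx xcm)
    lem : ∀ x → c < x → 2 * 0 + δ (x ≡ᵇ suc c) ≡ δ (x <ᵇ c + 2)
    lem x c<x = cong δ (bool-ext (λ t → <ᵇT (subst (_< c + 2) (sym (T≡ᵇ t)) (subst (suc c <_) (+-comm 2 c) (n<1+n (suc c)))))
                                 (λ t → ≡ᵇT (≤-antisym (≤-pred (subst (x <_) (+-comm c 2) (T<ᵇ t))) c<x)))

  sumFrom-bonus : sumFrom bonus c m ≡ 3
  sumFrom-bonus = begin
      sumFrom bonus c m ≡⟨ sumFrom-+ (λ x → 2 * δ (x ≡ᵇ c)) (λ x → δ (x ≡ᵇ suc c)) c m ⟩
      sumFrom (λ x → 2 * δ (x ≡ᵇ c)) c m + countFrom (λ x → x ≡ᵇ suc c) c m ≡⟨ cong₂ _+_ (sumFrom-* 2 (λ x → δ (x ≡ᵇ c)) c m) (countFrom-≡ᵇ (suc c) c m) ⟩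
      2 * countFrom (λ x → x ≡ᵇ c) c m + δ ((c ≤ᵇ suc c) ∧ (suc c <ᵇ c + m)) ≡⟨ cong₂ (λ a b → 2 * a + δ b) (countFrom-≡ᵇ c c m) (cong₂ _∧_ (≡true (≤ᵇT (n≤1+n c))) (≡true (<ᵇT sc<))) ⟩
      2 * δ ((c ≤ᵇ c) ∧ (c <ᵇ c + m)) + 1 ≡⟨ cong (λ b → 2 * δ b + 1) (cong₂ _∧_ (≡true (≤ᵇT (≤-refl {c}))) (≡true (<ᵇT c<cm))) ⟩
      3 ∎
    where
    open ≡-Reasoning
    sc< : suc c < c + m
    sc< = subst (_< c + m) (+-comm c 1) (+-monoʳ-< c m≥2)

  nGrandchildren-rank1 : nGrandchildren R ≡ m C 2 + 3
  nGrandchildren-rank1 = begin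
      nGrandchildren R ≡⟨ nGrandchildren≡sum ⟩
      sumFrom (λ x → if rg? x then nChildren (remove R x) else 0) 0 (suc (c + m)) ≡⟨ sumFrom-restrict-rightGens c≥1 _ (λ x h → if-not-rightGen (nChildren ∘ remove R) x h) ⟩
      sumFrom (λ x → if rg? x then nChildren (remove R x) else 0) c m ≡⟨ sumFrom-cong c m (λ x p q → if-nChildren-child x p q) ⟩
      sumFrom (λ x → if rg? x then gensAbove x + bonus x else 0) c m ≡⟨ sumFrom-if-+ rg? gensAbove bonus c m ⟩
      sumFrom (λ x → if rg? x then gensAbove x else 0) c m + sumFrom (λ x → if rg? x then bonus x else 0) c m
         ≡⟨ cong₂ _+_ (trans (sumFrom-countAbove rg? c m) (cong (_C 2) nGens≡m)) (sumFrom-cong c m (λ x p q → ift x p q)) ⟩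
      m C 2 + sumFrom bonus c m ≡⟨ cong (m C 2 +_) sumFrom-bonus ⟩
      m C 2 + 3 ∎
    where
    open ≡-Reasoning
    rgT : ∀ x → c ≤ x → x < c + m → rg? x ≡ true
    rgT x p q = ≡true (rg?-all x p q)
    if-nChildren-child : ∀ x → c ≤ x → x < c + m → (if rg? x then nChildren (remove R x) else 0) ≡ (if rg? x then gensAbove x + bonus x else 0)
    if-nChildren-child x p q rewrite rgT x p q = nChildren-child x p q
    ift : ∀ x → c ≤ x → x < c + m → (if rg? x then bonus x else 0) ≡ bonus x
    ift x p q rewrite rgT x p q = refl

module Rank1GreatGrandchildren (Λ : NumericalSemigroup) (k≡1 : Basics.k Λ ≡ 1) where
  open Basics Λ
  open Rank1 Λ k≡1
  open Rank1Grandchildren Λ k≡1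
  open DescendantSums Λ

  decomposition-without : ∀ x y a → suc c ≤ a → a + a ≤ y + m → a ≢ x → (y + m ∸ a) ≢ x → Decomposition (M-without x) m y
  decomposition-without x y a ca aa ax bx = a , y + m ∸ a , T∧ (M-≥c a (≤-trans (n≤1+n c) ca)) (Tnot (λ t → ax (T≡ᵇ t))) ,
      T∧ (M-≥c (y + m ∸ a) (≤-trans (n≤1+n c) (≤-trans ca a≤b))) (Tnot (λ t → bx (T≡ᵇ t))) , m<a , a≤b , b<y , eq
    where
    m<a : m < a
    m<a = subst (_< a) (sym m≡c) ca
    a≤ym : a ≤ y + m
    a≤ym = ≤-trans (m≤m+n a a) aa
    eq : a + (y + m ∸ a) ≡ y + m
    eq = m+[n∸m]≡n a≤ym
    a≤b : a ≤ y + m ∸ a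
    a≤b = +-cancelˡ-≤ a a (y + m ∸ a) (subst (a + a ≤_) (sym eq) aa)
    b<y : y + m ∸ a < y
    b<y = +-cancelˡ-< a (y + m ∸ a) y (subst (_< a + y) (sym eq) (subst (y + m <_) (+-comm y a) (+-monoʳ-< y m<a)))

  y+m≡y+c : ∀ y → y + m ≡ y + c
  y+m≡y+c y = cong (y +_) m≡c

  decomposition-without-far : ∀ x y → suc (suc c) ≤ x → x < y → y ≢ suc x → Decomposition (M-without x) m y
  decomposition-without-far x y cx xy ne = decomposition-without x y (suc c) ≤-refl le
      (λ e → <-irrefl e (≤-trans (n<1+n (suc c)) cx))
      (λ e → ne (trans (sym (m+[n∸m]≡n y≥1)) (cong suc (trans (sym b≡) e))))
    where
    y3 : suc (suc (suc c)) ≤ y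
    y3 = ≤-trans (s≤s cx) xy
    le : suc c + suc c ≤ y + m
    le = subst (suc c + suc c ≤_) (sym (y+m≡y+c y)) (subst (_≤ y + c) (sym (+-suc (suc c) c)) (+-monoˡ-≤ c (≤-trans (n≤1+n _) y3)))
    b≡ : y + m ∸ suc c ≡ y ∸ 1
    b≡ = trans (cong (_∸ suc c) (y+m≡y+c y)) (trans (cong (y + c ∸_) (+-comm 1 c)) (trans (sym (∸-+-assoc (y + c) c 1)) (cong (_∸ 1) (m+n∸n≡m y c))))
    y≥1 : 1 ≤ y
    y≥1 = ≤-trans (s≤s z≤n) y3

  no-decomposition-without-2+c : ¬ Decomposition (M-without (suc (suc c))) m (suc (suc (suc c)))
  no-decomposition-without-2+c (a , b , ma , mb , pa , ab , by , e) = 1+n≰n (subst (_≤ suc c + suc c) (trans e eq) le)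
    where
    b≢ : b ≢ suc (suc c)
    b≢ q = Tnot⁻ (proj₂ (and2 (M b) _ mb)) (≡ᵇT q)
    b≤ : b ≤ suc c
    b≤ = ≤-pred (≤∧≢⇒< (≤-pred by) b≢)
    le : a + b ≤ suc c + suc c
    le = +-mono-≤ (≤-trans ab b≤) b≤
    eq : suc (suc (suc c)) + m ≡ suc (suc c + suc c)
    eq = trans (y+m≡y+c (suc (suc (suc c)))) (3+c+c≡1+[2+c+1+c] c)

  decomposition-without-next : ∀ x → suc (suc (suc c)) ≤ x → Decomposition (M-without x) m (suc x)
  decomposition-without-next x x3 = decomposition-without x (suc x) (suc (suc c)) (n≤1+n _) le (λ e → <-irrefl e x3)
      (λ e → <-irrefl (trans (sym b≡) e) (∸-monoʳ-< (s≤s z≤n) x≥1))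
    where
    le : suc (suc c) + suc (suc c) ≤ suc x + m
    le = subst (suc (suc c) + suc (suc c) ≤_) (sym (y+m≡y+c (suc x))) (subst (_≤ suc x + c) (4+c+c≡[2+c]+[2+c] c) (+-monoˡ-≤ c (s≤s x3)))
    b≡ : suc x + m ∸ suc (suc c) ≡ x ∸ 1
    b≡ = trans (cong (_∸ suc (suc c)) (y+m≡y+c (suc x))) (trans (cong (suc x + c ∸_) (+-comm 2 c)) (trans (sym (∸-+-assoc (suc x + c) c 2)) (cong (_∸ 2) (m+n∸n≡m (suc x) c))))
    x≥1 : 1 ≤ x
    x≥1 = ≤-trans (s≤s z≤n) x3

  seed₁-without?≡ : ∀ x y → suc (suc c) ≤ x → x < y → noDecomp (M-without x) m y ≡ (x ≡ᵇ suc (suc c)) ∧ (y ≡ᵇ suc (suc (suc c)))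
  seed₁-without?≡ x y cx xy with y ≟ suc x
  ... | no ne = trans (noDecomp-false (M-without x) m y (decomposition-without-far x y cx xy ne)) (sym rhs-false)
    where
    rhs-false : (x ≡ᵇ suc (suc c)) ∧ (y ≡ᵇ suc (suc (suc c))) ≡ false
    rhs-false with x ≟ suc (suc c)
    ... | no q = cong (_∧ (y ≡ᵇ suc (suc (suc c)))) (≢⇒≡ᵇ≡false q)
    ... | yes refl = trans (cong (_∧ (y ≡ᵇ suc (suc (suc c)))) (≡ᵇ-refl (suc (suc c)))) (≢⇒≡ᵇ≡false ne)
  ... | yes refl with x ≟ suc (suc c)
  ...   | yes refl = trans (≡true (noDecomp-complete (M-without x) m (suc x) no-decomposition-without-2+c))
                           (sym (cong₂ _∧_ (≡ᵇ-refl x) (≡ᵇ-refl (suc x))))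
  ...   | no q = trans (noDecomp-false (M-without x) m (suc x) (decomposition-without-next x (≤∧≢⇒< cx (≢-sym q))))
                       (sym (cong (_∧ (suc x ≡ᵇ suc (suc (suc c)))) (≢⇒≡ᵇ≡false q)))

  sc<cm : suc c < c + m
  sc<cm = subst (_< c + m) (+-comm c 1) (+-monoʳ-< c m≥2)

  module ChildAtC+1 = Child Λ (suc c) (rg?-all (suc c) (n≤1+n c) sc<cm)

  count-c+1 : countFrom M 0 (suc c) ≡ 2
  count-c+1 = trans (countFrom-suc-true M c (M-≥c c ≤-refl)) (cong suc (trans (sym rank≡count) k≡1))

  rank-childAtC+1 : Basics.k ChildAtC+1.Λ' ≡ 2
  rank-childAtC+1 = trans ChildAtC+1.rank' count-c+1

  m<sc : m < suc c
  m<sc = subst (_< suc c) (sym m≡c) (n<1+n c)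

  λ2-childAtC+1 : elt ChildAtC+1.S'.R 2 ≡ suc (suc c)
  λ2-childAtC+1 = trans (cong (elt ChildAtC+1.S'.R) (sym cnt2)) (ChildAtC+1.S'.elt-count (ChildAtC+1.M'-intro (M-≥c (suc (suc c)) (≤-trans (n≤1+n c) (n≤1+n (suc c)))) (λ e → <-irrefl (sym e) (n<1+n (suc c)))))
    where
    cnt2 : countFrom ChildAtC+1.S'.M 0 (suc (suc c)) ≡ 2
    cnt2 = trans (countFrom-suc-false ChildAtC+1.S'.M (suc c) (λ t → ChildAtC+1.M'₂ t refl)) (trans (ChildAtC+1.count'-below (suc c) ≤-refl) count-c+1)

  u-childAtC+1 : Seeds.u ChildAtC+1.Λ' ≡ 2
  u-childAtC+1 = trans (cong₂ _∸_ λ2-childAtC+1 (ChildAtC+1.m'≡m m<sc)) (trans (cong (suc (suc c) ∸_) m≡c) (trans (cong (_∸ c) (+-comm 2 c)) (m+n∸m≡n c 2)))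

  m-2+ : Σ ℕ λ m2 → m ≡ suc (suc m2)
  m-2+ with m | m≥2
  ... | suc (suc m2) | _ = m2 , refl
  ... | suc zero | s≤s ()
  ... | zero | ()

  gensAbove-c+1 : gensAbove (suc c) ≡ m ∸ 2
  gensAbove-c+1 = trans (countFrom-all rg? (suc (suc c)) (c + m ∸ suc (suc c)) (λ x p q → rg?-all x (≤-trans (n≤1+n c) (≤-trans (n≤1+n _) p)) (subst (x <_) (m+[n∸m]≡n ssc≤) q)))
               (trans (cong (c + m ∸_) (+-comm 2 c)) (trans (sym (∸-+-assoc (c + m) c 2)) (cong (_∸ 2) (m+n∸m≡n c m))))
    where
    ssc≤ : suc (suc c) ≤ c + m
    ssc≤ = subst (_≤ c + m) (+-comm c 2) (+-monoʳ-≤ c m≥2)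

  nGrandchildren-childAtC+1 : nGrandchildren (remove R (suc c)) ≡ gensAbove (suc c) C 2 + ((m ∸ 2) + (2 ∸ δ (m <ᵇ 2 * 2)))
  nGrandchildren-childAtC+1 = begin
      nGrandchildren (remove R (suc c)) ≡⟨ Grandchildren.nGrandchildren≡ ChildAtC+1.Λ' (≤-reflexive (sym rank-childAtC+1)) ⟩
      ChildAtC+1.S'.nGens C 2 + ChildAtC+1.S'.nSeedGens ≡⟨ cong₂ _+_ (cong (_C 2) (trans (Rank2.nGens≡m∸1 ChildAtC+1.Λ' rank-childAtC+1) (cong (_∸ 1) (ChildAtC+1.m'≡m m<sc))))
                                     (trans (Rank2.nSeedGens≡ ChildAtC+1.Λ' rank-childAtC+1) (cong₂ (λ a b → a ∸ δ (b <ᵇ 2 * a)) u-childAtC+1 (ChildAtC+1.m'≡m m<sc))) ⟩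
      (m ∸ 1) C 2 + (2 ∸ δ (m <ᵇ 2 * 2)) ≡⟨ cong (_+ (2 ∸ δ (m <ᵇ 2 * 2))) (trans (cong (λ z → (z ∸ 1) C 2) (proj₂ m-2+)) (trans (C2-suc (proj₁ m-2+)) (cong (λ z → (z ∸ 2) + (z ∸ 2) C 2) (sym (proj₂ m-2+))))) ⟩
      (m ∸ 2) + (m ∸ 2) C 2 + (2 ∸ δ (m <ᵇ 2 * 2)) ≡⟨ re (m ∸ 2) ((m ∸ 2) C 2) _ ⟩
      (m ∸ 2) C 2 + ((m ∸ 2) + (2 ∸ δ (m <ᵇ 2 * 2))) ≡⟨ cong (λ z → z C 2 + ((m ∸ 2) + (2 ∸ δ (m <ᵇ 2 * 2)))) (sym gensAbove-c+1) ⟩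
      gensAbove (suc c) C 2 + ((m ∸ 2) + (2 ∸ δ (m <ᵇ 2 * 2))) ∎
    where
    open ≡-Reasoning
    re : ∀ a b d → a + b + d ≡ b + (a + d)
    re a b d = trans (cong (_+ d) (+-comm a b)) (+-assoc b a d)

  nGrandchildren-childAtC : nGrandchildren (remove R c) ≡ gensAbove c C 2 + (m + (m ∸ 1) + 3)
  nGrandchildren-childAtC = begin
      nGrandchildren (remove R c) ≡⟨ Rank1Grandchildren.nGrandchildren-rank1 ChildAtC.Λ' rank-childAtC ⟩
      Basics.m ChildAtC.Λ' C 2 + 3 ≡⟨ cong (λ z → z C 2 + 3) m-childAtC ⟩
      suc m C 2 + 3 ≡⟨ cong (_+ 3) (C2-suc m) ⟩
      m + m C 2 + 3 ≡⟨ cong (λ z → m + z C 2 + 3) (trans (proj₂ m-suc) (cong suc (sym m1≡))) ⟩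
      m + suc (m ∸ 1) C 2 + 3 ≡⟨ cong (λ z → m + z + 3) (C2-suc (m ∸ 1)) ⟩
      m + ((m ∸ 1) + (m ∸ 1) C 2) + 3 ≡⟨ m+[p+q]+3≡q+[m+p+3] m (m ∸ 1) ((m ∸ 1) C 2) ⟩
      (m ∸ 1) C 2 + (m + (m ∸ 1) + 3) ≡⟨ cong (λ z → z C 2 + (m + (m ∸ 1) + 3)) (sym gensAbove-c) ⟩
      gensAbove c C 2 + (m + (m ∸ 1) + 3) ∎
    where
    open ≡-Reasoning
    m1≡ : m ∸ 1 ≡ proj₁ m-suc
    m1≡ = cong (_∸ 1) (proj₂ m-suc)

  nGrandchildren-child-≥c+2 : ∀ x → suc (suc c) ≤ x → x < c + m → nGrandchildren (remove R x) ≡ gensAbove x C 2 + δ ((x ≡ᵇ suc (suc c)) ∧ (3 <ᵇ m))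
  nGrandchildren-child-≥c+2 x cx xcm = begin
      nGrandchildren (remove R x) ≡⟨ Grandchildren.nGrandchildren≡ ChildAtX.Λ' kx ⟩
      ChildAtX.S'.nGens C 2 + ChildAtX.S'.nSeedGens ≡⟨ cong₂ _+_ (cong (_C 2) (trans (ChildAtX.nGens'≡ m<x c≥1) (cong (gensAbove x +_) (cong δ t1F))))
                                    (ChildAtX.nSeedGens'≡ m<x c≥1) ⟩
      (gensAbove x + 0) C 2 + (countFrom (λ y → rg? y ∧ noDecomp (M-without x) m y) (suc x) L + δ (noDecomp M m x ∧ noDecomp (M-without x) m (x + m)))
         ≡⟨ cong₂ _+_ (cong (_C 2) (+-identityʳ (gensAbove x))) (cong₂ _+_ cnt≡ (cong (λ b → δ (b ∧ noDecomp (M-without x) m (x + m))) t1F)) ⟩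
      gensAbove x C 2 + (δ ((x ≡ᵇ suc (suc c)) ∧ (3 <ᵇ m)) + 0) ≡⟨ cong (gensAbove x C 2 +_) (+-identityʳ _) ⟩
      gensAbove x C 2 + δ ((x ≡ᵇ suc (suc c)) ∧ (3 <ᵇ m)) ∎
    where
    open ≡-Reasoning
    L = c + m ∸ suc x
    c≤x : c ≤ x
    c≤x = ≤-trans (n≤1+n c) (≤-trans (n≤1+n (suc c)) cx)
    module ChildAtX = Child Λ x (rg?-all x c≤x xcm)
    m<x : m < x
    m<x = subst (_< x) (sym m≡c) (≤-trans (n≤1+n (suc c)) cx)
    kx : 2 ≤ Basics.k ChildAtX.Λ'
    kx = subst (2 ≤_) (sym ChildAtX.rank') (subst (_≤ countFrom M 0 x) count-c+1 (countFrom-mono M (≤-trans (n≤1+n (suc c)) cx)))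
    t1F : noDecomp M m x ≡ false
    t1F = trans (seed₁?≡<c+2 x c≤x) (Tfalse (λ t → <-irrefl refl (<-≤-trans (T<ᵇ t) (subst (_≤ x) (+-comm 2 c) cx))))
    ∧c : ∀ a b → true ∧ (a ∧ b) ≡ (b ∧ a)
    ∧c true true = refl
    ∧c true false = refl
    ∧c false true = refl
    ∧c false false = refl
    sx≤ : suc x ≤ c + m
    sx≤ = xcm
    cnt≡ : countFrom (λ y → rg? y ∧ noDecomp (M-without x) m y) (suc x) L ≡ δ ((x ≡ᵇ suc (suc c)) ∧ (3 <ᵇ m))
    cnt≡ = trans (countFrom-cong (suc x) L (λ y p q → trans (cong₂ _∧_ (≡true (rg?-all y (≤-trans c≤x (≤-trans (n≤1+n x) p)) (subst (y <_) (m+[n∸m]≡n sx≤) q))) (seed₁-without?≡ x y cx p))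
                                           (∧c (x ≡ᵇ suc (suc c)) (y ≡ᵇ suc (suc (suc c))))))
            (trans (countFrom-≡ᵇ-∧ (suc (suc (suc c))) (x ≡ᵇ suc (suc c)) (suc x) L) fin1)
      where
      fin1 : δ ((x ≡ᵇ suc (suc c)) ∧ (suc x ≤ᵇ suc (suc (suc c))) ∧ (suc (suc (suc c)) <ᵇ suc x + L)) ≡ δ ((x ≡ᵇ suc (suc c)) ∧ (3 <ᵇ m))
      fin1 with x ≟ suc (suc c)
      ... | no ne rewrite ≢⇒≡ᵇ≡false ne = refl
      ... | yes refl = cong δ (cong ((suc (suc c) ≡ᵇ suc (suc c)) ∧_) (trans (cong₂ _∧_ (≡true (≤ᵇT (≤-refl {suc (suc (suc c))}))) (trans (cong (suc (suc (suc c)) <ᵇ_) (m+[n∸m]≡n sx≤)) (3+c<ᵇc+m≡3<ᵇm c m))) refl))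

  K0 : ℕ
  K0 = m + (m ∸ 1) + 3
  K1 : ℕ
  K1 = (m ∸ 2) + (2 ∸ δ (m <ᵇ 2 * 2))

  correction : ℕ → ℕ
  correction x = K0 * δ (x ≡ᵇ c) + K1 * δ (x ≡ᵇ suc c) + δ ((x ≡ᵇ suc (suc c)) ∧ (3 <ᵇ m))

  if-nGrandchildren-child : ∀ x → c ≤ x → x < c + m → (if rg? x then nGrandchildren (remove R x) else 0) ≡ (if rg? x then gensAbove x C 2 + correction x else 0)
  if-nGrandchildren-child x cx xcm rewrite ≡true (rg?-all x cx xcm) with c ≟ x
  ... | yes refl rewrite ≡ᵇ-refl c | ≢⇒≡ᵇ≡false {c} {suc c} (<⇒≢ (n<1+n c)) | ≢⇒≡ᵇ≡false {c} {suc (suc c)} (<⇒≢ (≤-trans (n<1+n c) (n≤1+n (suc c)))) =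
          trans nGrandchildren-childAtC (cong (gensAbove c C 2 +_) (a≡a*1+b*0+0 K0 K1))
  ... | no ne with suc c ≟ x
  ...   | yes refl rewrite ≢⇒≡ᵇ≡false {suc c} {c} (≢-sym (<⇒≢ (n<1+n c))) | ≡ᵇ-refl (suc c) | ≢⇒≡ᵇ≡false {suc c} {suc (suc c)} (<⇒≢ (n<1+n (suc c))) =
          trans nGrandchildren-childAtC+1 (cong (gensAbove (suc c) C 2 +_) (b≡a*0+b*1+0 K0 K1))
  ...   | no ne2 rewrite ≢⇒≡ᵇ≡false {x} {c} (≢-sym ne) | ≢⇒≡ᵇ≡false {x} {suc c} (≢-sym ne2) =
          trans (nGrandchildren-child-≥c+2 x x2 xcm) (cong (gensAbove x C 2 +_) (d≡a*0+b*0+d K0 K1 _))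
    where
    x2 : suc (suc c) ≤ x
    x2 = ≤∧≢⇒< (≤∧≢⇒< cx ne) ne2

  ift : ∀ x → c ≤ x → x < c + m → ∀ (g : ℕ → ℕ) → (if rg? x then g x else 0) ≡ g x
  ift x p q g rewrite ≡true (rg?-all x p q) = refl

  sumFrom-correction : sumFrom correction c m ≡ K0 * 1 + K1 * 1 + δ ((3 <ᵇ m) ∧ (c ≤ᵇ suc (suc c)) ∧ (suc (suc c) <ᵇ c + m))
  sumFrom-correction = begin
      sumFrom correction c m ≡⟨ sumFrom-+ (λ x → K0 * δ (x ≡ᵇ c) + K1 * δ (x ≡ᵇ suc c)) (λ x → δ ((x ≡ᵇ suc (suc c)) ∧ (3 <ᵇ m))) c m ⟩
      sumFrom (λ x → K0 * δ (x ≡ᵇ c) + K1 * δ (x ≡ᵇ suc c)) c m + countFrom (λ x → (x ≡ᵇ suc (suc c)) ∧ (3 <ᵇ m)) c m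
        ≡⟨ cong₂ _+_ (sumFrom-+ (λ x → K0 * δ (x ≡ᵇ c)) (λ x → K1 * δ (x ≡ᵇ suc c)) c m) (countFrom-≡ᵇ-∧ (suc (suc c)) (3 <ᵇ m) c m) ⟩
      sumFrom (λ x → K0 * δ (x ≡ᵇ c)) c m + sumFrom (λ x → K1 * δ (x ≡ᵇ suc c)) c m + δ ((3 <ᵇ m) ∧ (c ≤ᵇ suc (suc c)) ∧ (suc (suc c) <ᵇ c + m))
        ≡⟨ cong (_+ δ ((3 <ᵇ m) ∧ (c ≤ᵇ suc (suc c)) ∧ (suc (suc c) <ᵇ c + m))) (cong₂ _+_ (trans (sumFrom-* K0 _ c m) (cong (K0 *_) (trans (countFrom-≡ᵇ c c m) (cong₂ (λ a b → δ (a ∧ b)) (≡true (≤ᵇT (≤-refl {c}))) (≡true (<ᵇT c<cm))))))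
                                                      (trans (sumFrom-* K1 _ c m) (cong (K1 *_) (trans (countFrom-≡ᵇ (suc c) c m) (cong₂ (λ a b → δ (a ∧ b)) (≡true (≤ᵇT (n≤1+n c))) (≡true (<ᵇT sc<cm))))))) ⟩
      K0 * 1 + K1 * 1 + δ ((3 <ᵇ m) ∧ (c ≤ᵇ suc (suc c)) ∧ (suc (suc c) <ᵇ c + m)) ∎
    where open ≡-Reasoning

  nGreatGrandchildren≡ : nGreatGrandchildren R ≡ m C 3 + (K0 * 1 + K1 * 1 + δ ((3 <ᵇ m) ∧ (c ≤ᵇ suc (suc c)) ∧ (suc (suc c) <ᵇ c + m)))
  nGreatGrandchildren≡ = begin
      nGreatGrandchildren R ≡⟨ nGreatGrandchildren≡sum ⟩
      sumFrom (λ x → if rg? x then nGrandchildren (remove R x) else 0) 0 (suc (c + m)) ≡⟨ sumFrom-restrict-rightGens c≥1 _ (λ x h → if-not-rightGen (nGrandchildren ∘ remove R) x h) ⟩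
      sumFrom (λ x → if rg? x then nGrandchildren (remove R x) else 0) c m ≡⟨ sumFrom-cong c m (λ x p q → if-nGrandchildren-child x p q) ⟩
      sumFrom (λ x → if rg? x then gensAbove x C 2 + correction x else 0) c m ≡⟨ sumFrom-if-+ rg? (λ x → gensAbove x C 2) correction c m ⟩
      sumFrom (λ x → if rg? x then gensAbove x C 2 else 0) c m + sumFrom (λ x → if rg? x then correction x else 0) c m
        ≡⟨ cong₂ _+_ (trans (sumFrom-countAbove-C2 rg? c m) (cong (_C 3) nGens≡m)) (trans (sumFrom-cong c m (λ x p q → ift x p q correction)) sumFrom-correction) ⟩
      m C 3 + (K0 * 1 + K1 * 1 + δ ((3 <ᵇ m) ∧ (c ≤ᵇ suc (suc c)) ∧ (suc (suc c) <ᵇ c + m))) ∎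
    where open ≡-Reasoning

  nGreatGrandchildren-rank1-small : (m ≡ 2 ⊎ m ≡ 3) → nGreatGrandchildren R ≡ m C 3 + 3 * m + 1
  nGreatGrandchildren-rank1-small h = trans nGreatGrandchildren≡ (trans (cong (m C 3 +_) (rank1-correction-small m c h)) (sym (+-assoc (m C 3) (3 * m) 1)))

  nGreatGrandchildren-rank1-large : 4 ≤ m → nGreatGrandchildren R ≡ m C 3 + 3 * m + 3
  nGreatGrandchildren-rank1-large h = trans nGreatGrandchildren≡ (trans (cong (m C 3 +_) (rank1-correction-large m c h)) (sym (+-assoc (m C 3) (3 * m) 3)))

-- Rank 0

module Rank0 (Λ : NumericalSemigroup) (k≡0 : Basics.k Λ ≡ 0) where
  open Basics Λ
  open DescendantSums Λ

  c≡0 : c ≡ 0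
  c≡0 with c ≟ 0
  ... | yes e = e
  ... | no ne = ⊥-elim (<-irrefl (sym k≡0) (subst (0 <_) (sym rank≡count) (subst (_≤ countFrom M 0 c) (countFrom-suc-true M 0 M-0) (countFrom-mono M (n≢0⇒n>0 ne)))))

  M-1 : T (M 1)
  M-1 = M-≥c 1 (subst (_≤ 1) (sym c≡0) z≤n)

  m≡1 : m ≡ 1
  m≡1 = ≤-antisym (m-minimal 1 M-1 (λ ())) m>0

  rg?-1 : T (rg? 1)
  rg?-1 = isRightGen-complete 1 (subst (_≤ 1) (sym c≡0) z≤n , (λ ()) , M-1 , nd)
    where
    nd : ¬ Decomposition M 0 1
    nd (a , b , _ , _ , pa , ab , b<1 , _) = <-irrefl refl (<-≤-trans pa (≤-trans ab (≤-pred b<1)))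

  1+c+m≡2 : suc (c + m) ≡ 2
  1+c+m≡2 = cong suc (cong₂ _+_ c≡0 m≡1)

  nChildren-rank0 : nChildren R ≡ 1
  nChildren-rank0 = trans (length-filter-upTo rg? (suc (c + m))) (trans (cong (countFrom rg? 0) 1+c+m≡2) (cong (λ b → b + 0) (cong δ (≡true rg?-1))))

  module C = Child Λ 1 rg?-1

  k'≡1 : Basics.k C.Λ' ≡ 1
  k'≡1 = trans C.rank' (countFrom-suc-true M 0 M-0)

  m'≡2 : Basics.m C.Λ' ≡ 2
  m'≡2 = trans (cong (elt C.S'.R) (sym cnt2)) (C.S'.elt-count (C.M'-intro (M-≥c 2 (subst (_≤ 2) (sym c≡0) z≤n)) (λ ())))
    where
    cnt2 : countFrom C.S'.M 0 2 ≡ 1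
    cnt2 = trans (countFrom-suc-false C.S'.M 1 (λ t → C.M'₂ t refl)) (trans (C.count'-below 1 ≤-refl) (countFrom-suc-true M 0 M-0))

  sumFrom-rightGens : ∀ (h : ℕ → ℕ) → sumFrom (λ x → if rg? x then h x else 0) 0 (suc (c + m)) ≡ h 1
  sumFrom-rightGens h = trans (cong (sumFrom (λ x → if rg? x then h x else 0) 0) 1+c+m≡2) (trans (cong (λ b → (if b then h 1 else 0) + 0) (≡true rg?-1)) (+-identityʳ (h 1)))

  nGrandchildren-rank0 : nGrandchildren R ≡ 2
  nGrandchildren-rank0 = trans nGrandchildren≡sum (trans (sumFrom-rightGens (nChildren ∘ remove R))
           (trans (C.S'.nChildren≡nGens (subst (1 ≤_) (sym C.conductor') (s≤s z≤n))) (trans (Rank1.nGens≡m C.Λ' k'≡1) m'≡2)))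

  nGreatGrandchildren-rank0 : nGreatGrandchildren R ≡ 4
  nGreatGrandchildren-rank0 = trans nGreatGrandchildren≡sum (trans (sumFrom-rightGens (nGrandchildren ∘ remove R))
           (trans (Rank1Grandchildren.nGrandchildren-rank1 C.Λ' k'≡1) (cong (λ z → z C 2 + 3) m'≡2)))

mainTheorem5 : (Λ : NumericalSemigroup) →
    let R = NumericalSemigroup.raw Λ
        k = rank R
        m = elt R 1
        u = elt R 2 ∸ elt R 1
        v = elt R 3 ∸ elt R 2
        S = seedStream R
        nc = nChildren R
        δa = δ (m <ᵇ 2 * u)
        δb = δ ((u ≡ᵇ m) ∨ not (2 * u ≡ᵇ m))
        δc = δ ((u <ᵇ m ∸ 1) ∧ not (2 * u + 1 ≡ᵇ m))
        δd = δ (u ≡ᵇ m ∸ 1)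
    in ((k ≡ 0 → nc ≡ 1)
        × (k ≡ 1 → nc ≡ m)
        × (k ≡ 2 → nc ≡ m ∸ 1)
        × (3 ≤ k → nc ≡ w 0 (m ∸ 1) S))
     × ((k ≡ 0 → nGrandchildren R ≡ 2)
        × (k ≡ 1 → nGrandchildren R ≡ m C 2 + 3)
        × (2 ≤ k → nGrandchildren R ≡ nc C 2 + w 0 (u ∸ 1) (S ⋀ (S ≪ m))))
     × ((k ≡ 0 → nGreatGrandchildren R ≡ 4)
        × (k ≡ 1 → (m ≡ 2 ⊎ m ≡ 3) → nGreatGrandchildren R ≡ m C 3 + 3 * m + 1)
        × (k ≡ 1 → 4 ≤ m → nGreatGrandchildren R ≡ m C 3 + 3 * m + 3)
        × (k ≡ 2 → nGreatGrandchildren R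
                     ≡ (m ∸ 1) C 3 + (u ∸ δa) * (m ∸ 2) + δb + 2 * δc + δd)
        × (3 ≤ k → nGreatGrandchildren R
                     ≡ nc C 3 + w 0 (u ∸ 1) (S ⋀ (S ≪ m)) * (nc ∸ 1)
                       + w 0 (v ∸ 1) ((S ⋀ (S ≪ u)) ⋀ (S ≪ (u + m)))))
mainTheorem5 Λ =
    ( Rank0.nChildren-rank0 Λ
    , Rank1.nChildren-rank1 Λ
    , Rank2.nChildren-rank2 Λ
    , (λ k≥3 → Seeds.RankAtLeast2.nChildren≡w Λ (≤-trans (n≤1+n 2) k≥3)) )
  , ( Rank0.nGrandchildren-rank0 Λ
    , Rank1Grandchildren.nGrandchildren-rank1 Λ
    , Seeds.RankAtLeast2.nGrandchildren≡w Λ )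
  , ( Rank0.nGreatGrandchildren-rank0 Λ
    , Rank1GreatGrandchildren.nGreatGrandchildren-rank1-small Λ
    , Rank1GreatGrandchildren.nGreatGrandchildren-rank1-large Λ
    , Rank2.nGreatGrandchildren-rank2 Λ
    , RankAtLeast3.nGreatGrandchildren≡w Λ )
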